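{- The $\mathbb{Q}$-linear map $\mathcal{G}:\mathrm{PolyMat}\to\mathrm{QSym}$ is a homomorphism of Hopf algebras (compatible with product, coproduct, unit and counit).
   Context: A polymatroid is ${\bf X}=(X,\operatorname{rk})$, $X$ finite, $\operatorname{rk}$ from subsets of $X$ to $\{0,1,2,\dots\}$ with $\operatorname{rk}(\emptyset)=0$, monotone, submodular. Restriction ${\bf X}|_A=(A,\operatorname{rk}|_A)$; contraction ${\bf X}/A=(X\setminus A,\operatorname{rk}')$ with $\operatorname{rk}'(B)=\operatorname{rk}(A\cup B)-\operatorname{rk}(A)$; direct sum ${\bf X}\oplus{\bf Y}$ on $X\sqcup Y$ with $\operatorname{rk}(A\cup B)=\operatorname{rk}_X(A)+\operatorname{rk}_Y(B)$. $\mathrm{PolyMat}$ has $\mathbb{Q}$-basis the isomorphism classes $[{\bf X}]$, product $[{\bf X}][{\bf Y}]=[{\bf X}\oplus{\bf Y}]$, coproduct $\Delta[{\bf X}]=\sum_{A\subseteq X}[{\bf X}|_A]\otimes[{\bf X}/A]$, unit $[\emptyset]$, counit $\epsilon[{\bf X}]=1$ if $X=\emptyset$ and $0$ otherwise. $\mathrm{QSym}$ is the Hopf algebra over $\mathbb{Q}$ with basis $P_\alpha$ ($\alpha$ finite sequences of positive integers, $P_{()}=1$), product $P_\alpha P_\beta=\sum_\gamma P_\gamma$ over all $\binom{\ell(\alpha)+\ell(\beta)}{\ell(\alpha)}$ shuffles $\gamma$ of $\alpha$ and $\beta$ ($\ell$ = length), coproduct $\Delta P_\alpha=\sum_{\beta\gamma=\alpha}P_\beta\otimes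 P_\gamma$ over all ways of writing $\alpha$ as a concatenation, counit $\epsilon(P_\alpha)=1$ if $\alpha=()$, else $0$ (the graded dual of $\mathbb{Q}\langle p_1,p_2,\dots\rangle$ with $p_i$ primitive). $U_a=P_{(a_1+1,\dots,a_d+1)}$ for $a$ a sequence of nonnegative integers. $\mathcal{G}[{\bf X}]=\sum_{\underline X}U_{r(\underline X)}$ over all maximal chains $\emptyset=X_0\subset X_1\subset\cdots\subset X_d=X$ ($|X_i|=i$, $d=|X|$), with $r(\underline X)=(\operatorname{rk}(X_1)-\operatorname{rk}(X_0),\dots,\operatorname{rk}(X_d)-\operatorname{rk}(X_{d-1}))$, extended linearly. -}

module Defs where

open import Data.Nat as ℕ using (ℕ; zero; suc; _∸_; _≤_)
open import Data.Rational as ℚ using (ℚ; 0ℚ; 1ℚ)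
open import Data.Bool using (Bool; true; false; if_then_else_)
open import Data.Vec as Vec using (Vec; []; _∷_)
open import Data.Fin using (Fin)
open import Data.Fin.Subset using (Subset; _⊆_; _∪_; _∩_; _─_; ⁅_⁆; ⊥; ∣_∣)
open import Data.List as List using (List; []; _∷_; _++_; map; concatMap)
open import Data.List.Properties using (≡-dec)
open import Data.List.Relation.Unary.All using (All)
open import Data.Product using (_×_; _,_; proj₁; proj₂; map₁)
open import Relation.Binary.PropositionalEquality using (_≡_)
open import Relation.Nullary.Decidable using (does; Dec)

-- QSym: elements are formal Q-linear combinations  Σ c · P_α ,
-- represented by a list of (coefficient , α) and compared through
-- their coefficient functions (so the representation is irrelevant).

Comp : Set
Comp = List ℕ

QSym : Set
QSym = List (ℚ × Comp)

_≟C_ : (α β : Comp) → Dec (α ≡ β)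
_≟C_ = ≡-dec ℕ._≟_

coeff : QSym → Comp → ℚ
coeff [] α = 0ℚ
coeff ((c , β) ∷ xs) α = (if does (β ≟C α) then c else 0ℚ) ℚ.+ coeff xs α

_≈Q_ : QSym → QSym → Set
x ≈Q y = ∀ α → coeff x α ≡ coeff y α

P : Comp → QSym
P α = (1ℚ , α) ∷ []

U : List ℕ → QSym
U a = P (map suc a)

scale : ℚ → QSym → QSym
scale c = map (map₁ (c ℚ.*_))

shuffles : Comp → Comp → List Comp
shuffles [] ys = ys ∷ []
shuffles (x ∷ xs) [] = (x ∷ xs) ∷ []
shuffles (x ∷ xs) (y ∷ ys) =
  map (x ∷_) (shuffles xs (y ∷ ys)) ++ map (y ∷_) (shuffles (x ∷ xs) ys)

_*Q_ : QSym → QSym → QSym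
x *Q y = concatMap (λ { (a , α) → concatMap (λ { (b , β) →
           map (λ γ → (a ℚ.* b , γ)) (shuffles α β) }) y }) x

oneQ : QSym
oneQ = P []

εQ : QSym → ℚ
εQ x = coeff x []

-- QSym ⊗ QSym : formal combinations of P_β ⊗ P_γ
QSym2 : Set
QSym2 = List (ℚ × Comp × Comp)

coeff2 : QSym2 → Comp → Comp → ℚ
coeff2 [] β γ = 0ℚ
coeff2 ((c , β' , γ') ∷ xs) β γ =
  (if does (β' ≟C β) then (if does (γ' ≟C γ) then c else 0ℚ) else 0ℚ) ℚ.+ coeff2 xs β γ

_≈Q2_ : QSym2 → QSym2 → Set
x ≈Q2 y = ∀ β γ → coeff2 x β γ ≡ coeff2 y β γ

deconcat : Comp → List (Comp × Comp)
deconcat [] = ([] , []) ∷ []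
deconcat (a ∷ α) = ([] , a ∷ α) ∷ map (map₁ (a ∷_)) (deconcat α)

ΔQ : QSym → QSym2
ΔQ x = concatMap (λ { (c , α) → map (λ { (β , γ) → (c , β , γ) }) (deconcat α) }) x

_⊗Q_ : QSym → QSym → QSym2
x ⊗Q y = concatMap (λ { (a , α) → map (λ { (b , β) → (a ℚ.* b , α , β) }) y }) x

-- Set functions / polymatroids.  A finite ground set is modelled as a
-- subset `ground` of Fin n; `rk` is only relevant on subsets of it.

record SetFn : Set where
  constructor setFn
  field
    n      : ℕ
    ground : Subset n
    rk     : Subset n → ℕ
open SetFn public

record IsPolymatroid (X : SetFn) : Set where
  field
    rk-∅       : rk X ⊥ ≡ 0
    monotone   : ∀ A B → A ⊆ ground X → B ⊆ ground X → A ⊆ B → rk X A ≤ rk X B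
    submodular : ∀ A B → A ⊆ ground X → B ⊆ ground X →
                 rk X (A ∪ B) ℕ.+ rk X (A ∩ B) ≤ rk X A ℕ.+ rk X B

restrict : (X : SetFn) → Subset (n X) → SetFn
restrict X A = setFn (n X) A (rk X)

contract : (X : SetFn) → Subset (n X) → SetFn
contract X A = setFn (n X) (ground X ─ A) (λ B → rk X (A ∪ B) ∸ rk X A)

-- direct sum, ground set the disjoint union (first n X coordinates, then n Y)
_⊕_ : SetFn → SetFn → SetFn
X ⊕ Y = setFn (n X ℕ.+ n Y) (ground X Vec.++ ground Y)
  (λ C → rk X (Vec.take (n X) C) ℕ.+ rk Y (Vec.drop (n X) C))

emptyPM : SetFn
emptyPM = setFn 0 [] (λ _ → 0)

elems : ∀ {m} → Subset m → List (Fin m)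
elems {m} T = List.filterᵇ (Vec.lookup T) (List.allFin m)

subsetsOf : ∀ {m} → Subset m → List (Subset m)
subsetsOf [] = [] ∷ []
subsetsOf (false ∷ S) = map (false ∷_) (subsetsOf S)
subsetsOf (true ∷ S) = map (false ∷_) (subsetsOf S) ++ map (true ∷_) (subsetsOf S)

-- maxChains k T : all chains X_0 ⊂ X_1 ⊂ ... ⊂ X_k = T with |X_i| = i
-- (listed as [X_0, ..., X_k]), built by choosing X_{k-1} = T ∖ {x}.
-- Used with k = |T|.
maxChains : ∀ {m} → ℕ → Subset m → List (List (Subset m))
maxChains zero T = (T ∷ []) ∷ []
maxChains (suc k) T =
  concatMap (λ x → map (_++ (T ∷ [])) (maxChains k (T ─ ⁅ x ⁆))) (elems T)

rankSeq : ∀ {m} → (Subset m → ℕ) → List (Subset m) → List ℕ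
rankSeq r c = List.zipWith (λ A B → r B ∸ r A) c (List.drop 1 c)

𝒢₀ : SetFn → QSym
𝒢₀ X = concatMap (λ c → U (rankSeq (rk X) c)) (maxChains ∣ ground X ∣ (ground X))

PolyMat : Set
PolyMat = List (ℚ × SetFn)

IsPolyMatElt : PolyMat → Set
IsPolyMatElt x = All (λ p → IsPolymatroid (proj₂ p)) x

PolyMat2 : Set
PolyMat2 = List (ℚ × SetFn × SetFn)

_*P_ : PolyMat → PolyMat → PolyMat
x *P y = concatMap (λ { (a , X) → map (λ { (b , Y) → (a ℚ.* b , X ⊕ Y) }) y }) x

oneP : PolyMat
oneP = (1ℚ , emptyPM) ∷ []

ΔP : PolyMat → PolyMat2
ΔP x = concatMap (λ { (c , X) →
         map (λ A → (c , restrict X A , contract X A)) (subsetsOf (ground X)) }) x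

εP : PolyMat → ℚ
εP [] = 0ℚ
εP ((c , X) ∷ xs) = (if ∣ ground X ∣ ℕ.≡ᵇ 0 then c else 0ℚ) ℚ.+ εP xs

𝒢 : PolyMat → QSym
𝒢 x = concatMap (λ { (c , X) → scale c (𝒢₀ X) }) x

𝒢⊗𝒢 : PolyMat2 → QSym2
𝒢⊗𝒢 x = concatMap (λ { (c , X , Y) →
           map (λ { (a , β , γ) → (c ℚ.* a , β , γ) }) (𝒢₀ X ⊗Q 𝒢₀ Y) }) x

module Submission where

-- Reading a maximal chain ∅ = X₀ ⊂ ⋯ ⊂ X_d = X as the order x₁, …, x_d in which elements
-- enter it identifies maximal chains with enumerations of X, and r(X₀ ⊂ ⋯ ⊂ X_d) with the
-- marginal gains rk(X_i) − rk(X_{i−1}). So 𝒢[X] is the multiset, over all enumerations, of the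
-- gain compositions, and each identity becomes a bijection of multisets of terms.
-- Product: the enumerations of X ⊕ Y are exactly the interleavings of an enumeration of X with
-- one of Y, and as the rank of X ⊕ Y is additive the gains of an interleaving are the matching
-- interleaving of the two gain sequences; this is the shuffle product.
-- Coproduct: cutting an enumeration of X after i elements gives, bijectively, a subset A, an
-- enumeration of A and one of X ∖ A. The gains along the prefix are those of X|A and those along
-- the suffix are those of X/A (monotonicity keeps the truncated subtraction in rk of X/A exact);
-- this is deconcatenation.
-- Unit and counit: only the empty ground set has the empty composition.

open import Algebra.Bundles using (CommutativeMonoid)
import Algebra.Properties.CommutativeSemigroup as CommSemigroupProperties
open import Data.Bool using (Bool; true; false; _∨_; if_then_else_)
open import Data.Bool.Properties using (T-≡)
open import Data.Empty using (⊥-elim)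
open import Data.Fin as Fin using (Fin; zero; suc; _↑ˡ_; _↑ʳ_; splitAt)
import Data.Fin.Properties as FinP
open import Data.Fin.Subset using (Subset; ⁅_⁆; _∪_; _─_; _-_; ∣_∣; Nonempty)
  renaming (⊥ to ∅; _∈_ to _∈ₛ_; _∉_ to _∉ₛ_; _⊆_ to _⊆ₛ_)
import Data.Fin.Subset.Properties as SubsetP
open import Data.List as List using (List; []; _∷_; _++_; map; concatMap; foldl; foldr; reverse)
import Data.List.Properties as ListP
open import Data.List.Membership.Propositional using (_∈_; find; lose)
import Data.List.Membership.Propositional.Properties as ∈P
open import Data.List.Membership.Propositional.Properties.WithK using (unique∧set⇒bag)
open import Data.List.Relation.Unary.Any using (Any; here; there)
open import Data.List.Relation.Unary.Any.Properties using (>>=↔; swap↔; Any-cong)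
open import Data.List.Relation.Unary.All as All using (All; []; _∷_)
import Data.List.Relation.Unary.All.Properties as AllP
open import Data.List.Relation.Unary.AllPairs as AllPairs using ([]; _∷_)
import Data.List.Relation.Unary.AllPairs.Properties as AllPairsP
open import Data.List.Relation.Unary.Unique.Propositional using (Unique)
import Data.List.Relation.Unary.Unique.Propositional.Properties as UniqueP
open import Data.List.Relation.Binary.Disjoint.Propositional using (Disjoint)
open import Data.List.Relation.Binary.BagAndSetEquality using (bag; _∼[_]_; ++-cong; map-cong; >>=-cong; [_]-Equality; ∼bag⇒↭)
open import Data.List.Relation.Binary.Permutation.Propositional using (_↭_; ↭-sym; ↭⇒↭ₛ)
import Data.List.Relation.Binary.Permutation.Propositional.Properties as PermP
import Data.List.Relation.Binary.Permutation.Setoid.Properties as PermSetoidP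
open import Data.List.Relation.Ternary.Interleaving using (Interleaving; []; _∷ˡ_; _∷ʳ_)
import Data.List.Relation.Ternary.Interleaving.Properties as InterleavingP
import Data.List.Relation.Ternary.Interleaving.Propositional as PropInterleaving
open import Data.Nat as ℕ using (ℕ; zero; suc; _+_; _∸_; _≤_)
import Data.Nat.Properties as ℕP
open import Data.Product as Product using (_×_; _,_; proj₁; proj₂; ∃; ∃₂; map₁)
import Data.Product.Properties as ProductP
open import Data.Rational as ℚ using (ℚ; 0ℚ; 1ℚ)
import Data.Rational.Properties as ℚP
open import Data.Sum as Sum using (_⊎_; inj₁; inj₂; [_,_]′)
open import Data.Vec as Vec using (Vec; []; _∷_; here; there)
import Data.Vec.Properties as VecP
open import Function using (Injective; _⇔_; mk⇔; Equivalence; _∘_)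
open import Function.Related.Propositional as Related using (SK-sym)
open import Relation.Binary.Bundles using (Setoid)
open import Relation.Binary.PropositionalEquality using (_≡_; _≢_; refl; sym; trans; cong; cong₂; subst; setoid; module ≡-Reasoning)
open import Relation.Nullary using (does; yes; no)
open import Relation.Nullary.Decidable using (dec-false)

open import Defs

open Equivalence using (to; from)

private
  variable
    A B C : Set
    m : ℕ

  module Bag {A : Set} = Setoid ([ bag ]-Equality A)

-- Bag equality of lists

concatMap-comm : (f : A → B → List C) (xs : List A) (ys : List B) →
  concatMap (λ x → concatMap (f x) ys) xs ∼[ bag ] concatMap (λ y → concatMap (λ x → f x y) xs) ys
concatMap-comm f xs ys {z} =
  z ∈ concatMap (λ x → concatMap (f x) ys) xs     ↔⟨ SK-sym >>=↔ ⟩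
  Any (λ x → z ∈ concatMap (f x) ys) xs           ↔⟨ Any-cong (λ x → SK-sym >>=↔) (_ ∎) ⟩
  Any (λ x → Any (λ y → z ∈ f x y) ys) xs         ↔⟨ swap↔ ⟩
  Any (λ y → Any (λ x → z ∈ f x y) xs) ys         ↔⟨ Any-cong (λ y → >>=↔) (_ ∎) ⟩
  Any (λ y → z ∈ concatMap (λ x → f x y) xs) ys   ↔⟨ >>=↔ ⟩
  z ∈ concatMap (λ y → concatMap (λ x → f x y) xs) ys ∎
  where open Related.EquationalReasoning

concatMap-concatMap : (g : B → List C) (f : A → List B) (xs : List A) →
  concatMap g (concatMap f xs) ≡ concatMap (concatMap g ∘ f) xs
concatMap-concatMap g f [] = refl
concatMap-concatMap g f (x ∷ xs) =
  trans (ListP.concatMap-++ g (f x) (concatMap f xs)) (cong (concatMap g (f x) ++_) (concatMap-concatMap g f xs))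

concatMap-cong-bag : {f g : A → List B} (xs : List A) → (∀ x → f x ∼[ bag ] g x) → concatMap f xs ∼[ bag ] concatMap g xs
concatMap-cong-bag xs = >>=-cong (Bag.refl {x = xs})

concatMap-cong-All : {P : A → Set} {f g : A → List B} {xs : List A} → All P xs →
  (∀ {x} → P x → f x ∼[ bag ] g x) → concatMap f xs ∼[ bag ] concatMap g xs
concatMap-cong-All [] f∼g = Bag.refl
concatMap-cong-All (px ∷ pxs) f∼g = ++-cong (f∼g px) (concatMap-cong-All pxs f∼g)

Unique-concatMap⁺ : {f : A → List B} {xs : List A} → Unique xs → (∀ x → Unique (f x)) →
  (∀ {x x′ z} → z ∈ f x → z ∈ f x′ → x ≡ x′) → Unique (concatMap f xs)
Unique-concatMap⁺ {f = f} {xs} xs! fx! fibres =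
  UniqueP.concat⁺ (AllP.map⁺ (All.universal fx! xs))
    (AllPairsP.map⁺ (AllPairs.map (λ x≢x′ {_} (z∈fx , z∈fx′) → x≢x′ (fibres z∈fx z∈fx′)) xs!))

Unique-resp-↭ : {xs ys : List A} → xs ↭ ys → Unique xs → Unique ys
Unique-resp-↭ {A = A} p = PermSetoidP.Unique-resp-↭ (setoid A) (↭⇒↭ₛ p)

Unique-++⁻ : (xs : List A) {ys : List A} → Unique (xs ++ ys) → Unique xs × Unique ys × Disjoint xs ys
Unique-++⁻ [] ys! = [] , ys! , λ ()
Unique-++⁻ (x ∷ xs) (x∉ ∷ xsys!) with Unique-++⁻ xs xsys!
... | xs! , ys! , disj =
  All.tabulate (λ z∈xs → All.lookup x∉ (∈P.∈-++⁺ˡ z∈xs)) ∷ xs! , ys! ,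
  λ { (here refl , x∈ys) → All.lookup x∉ (∈P.∈-++⁺ʳ xs x∈ys) refl ; (there z∈xs , z∈ys) → disj (z∈xs , z∈ys) }

-- Splittings and interleavings

splits : List A → List (List A × List A)
splits [] = ([] , []) ∷ []
splits (x ∷ l) = ([] , x ∷ l) ∷ map (map₁ (x ∷_)) (splits l)

deconcat≡splits : (α : Comp) → deconcat α ≡ splits α
deconcat≡splits [] = refl
deconcat≡splits (a ∷ α) = cong (λ s → ([] , a ∷ α) ∷ map (map₁ (a ∷_)) s) (deconcat≡splits α)

∈-splits⁻ : ∀ (l : List A) {p q} → (p , q) ∈ splits l → p ++ q ≡ l
∈-splits⁻ [] (here refl) = refl
∈-splits⁻ (x ∷ l) (here refl) = refl
∈-splits⁻ (x ∷ l) (there pq∈) with ∈P.∈-map⁻ (map₁ (x ∷_)) pq∈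
... | _ , pq′∈ , refl = cong (x ∷_) (∈-splits⁻ l pq′∈)

∈-splits⁺ : ∀ (p q : List A) → (p , q) ∈ splits (p ++ q)
∈-splits⁺ [] [] = here refl
∈-splits⁺ [] (x ∷ q) = here refl
∈-splits⁺ (x ∷ p) q = there (∈P.∈-map⁺ (map₁ (x ∷_)) (∈-splits⁺ p q))

splits-unique : ∀ (l : List A) → Unique (splits l)
splits-unique [] = [] ∷ []
splits-unique (x ∷ l) =
  All.tabulate (λ pq∈ → head≢ (∈P.∈-map⁻ (map₁ (x ∷_)) pq∈)) ∷ UniqueP.map⁺ map₁-∷-injective (splits-unique l)
  where
  head≢ : ∀ {pq} → ∃ (λ u → u ∈ splits l × pq ≡ map₁ (x ∷_) u) → ([] , x ∷ l) ≢ pq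
  head≢ (_ , _ , refl) ()
  map₁-∷-injective : ∀ {u v} → map₁ (x ∷_) u ≡ map₁ (x ∷_) v → u ≡ v
  map₁-∷-injective {_ , _} {_ , _} refl = refl

splits-map : (f : A → B) (l : List A) → splits (map f l) ≡ map (Product.map (map f) (map f)) (splits l)
splits-map f [] = refl
splits-map f (x ∷ l) = cong (([] , f x ∷ map f l) ∷_) (begin
  map (map₁ (f x ∷_)) (splits (map f l))                                ≡⟨ cong (map (map₁ (f x ∷_))) (splits-map f l) ⟩
  map (map₁ (f x ∷_)) (map (Product.map (map f) (map f)) (splits l))    ≡⟨ ListP.map-∘ (splits l) ⟨
  map (map₁ (f x ∷_) ∘ Product.map (map f) (map f)) (splits l)          ≡⟨ ListP.map-∘ (splits l) ⟩
  map (Product.map (map f) (map f)) (map (map₁ (x ∷_)) (splits l))      ∎)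
  where open ≡-Reasoning

cartesianProduct≡concatMap : (xs : List A) (ys : List B) → List.cartesianProduct xs ys ≡ concatMap (λ x → map (x ,_) ys) xs
cartesianProduct≡concatMap [] ys = refl
cartesianProduct≡concatMap (x ∷ xs) ys = cong (map (x ,_) ys ++_) (cartesianProduct≡concatMap xs ys)

interleavings : List A → List A → List (List A)
interleavings [] ys = ys ∷ []
interleavings (x ∷ xs) [] = (x ∷ xs) ∷ []
interleavings (x ∷ xs) (y ∷ ys) =
  map (x ∷_) (interleavings xs (y ∷ ys)) ++ map (y ∷_) (interleavings (x ∷ xs) ys)

shuffles≡interleavings : (α β : Comp) → shuffles α β ≡ interleavings α β
shuffles≡interleavings [] β = refl
shuffles≡interleavings (a ∷ α) [] = refl
shuffles≡interleavings (a ∷ α) (b ∷ β) =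
  cong₂ (λ s t → map (a ∷_) s ++ map (b ∷_) t) (shuffles≡interleavings α (b ∷ β)) (shuffles≡interleavings (a ∷ α) β)

interleavings-map : (f : A → B) (xs ys : List A) →
  interleavings (map f xs) (map f ys) ≡ map (map f) (interleavings xs ys)
interleavings-map f [] ys = refl
interleavings-map f (x ∷ xs) [] = refl
interleavings-map f (x ∷ xs) (y ∷ ys) = begin
  map (f x ∷_) (interleavings (map f xs) (map f (y ∷ ys))) ++ map (f y ∷_) (interleavings (map f (x ∷ xs)) (map f ys))
    ≡⟨ cong₂ (λ s t → map (f x ∷_) s ++ map (f y ∷_) t) (interleavings-map f xs (y ∷ ys)) (interleavings-map f (x ∷ xs) ys) ⟩
  map (f x ∷_) (map (map f) (interleavings xs (y ∷ ys))) ++ map (f y ∷_) (map (map f) (interleavings (x ∷ xs) ys))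
    ≡⟨ cong₂ _++_ (map-∘-comm (interleavings xs (y ∷ ys))) (map-∘-comm (interleavings (x ∷ xs) ys)) ⟩
  map (map f) (map (x ∷_) (interleavings xs (y ∷ ys))) ++ map (map f) (map (y ∷_) (interleavings (x ∷ xs) ys))
    ≡⟨ ListP.map-++ (map f) (map (x ∷_) (interleavings xs (y ∷ ys))) _ ⟨
  map (map f) (interleavings (x ∷ xs) (y ∷ ys)) ∎
  where
  open ≡-Reasoning
  map-∘-comm : ∀ {z} (ls : List (List _)) → map (f z ∷_) (map (map f) ls) ≡ map (map f) (map (z ∷_) ls)
  map-∘-comm ls = trans (sym (ListP.map-∘ ls)) (ListP.map-∘ ls)

interleavings-unique : (xs ys : List A) → Disjoint xs ys → Unique (interleavings xs ys)
interleavings-unique [] ys disj = [] ∷ []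
interleavings-unique (x ∷ xs) [] disj = [] ∷ []
interleavings-unique (x ∷ xs) (y ∷ ys) disj =
  UniqueP.++⁺ (UniqueP.map⁺ ListP.∷-injectiveʳ (interleavings-unique xs (y ∷ ys) (λ (u , v) → disj (there u , v))))
              (UniqueP.map⁺ ListP.∷-injectiveʳ (interleavings-unique (x ∷ xs) ys (λ (u , v) → disj (u , there v))))
              λ (u , v) → disj (here refl , heads (∈P.∈-map⁻ (x ∷_) u) (∈P.∈-map⁻ (y ∷_) v))
  where
  heads : ∀ {l} → ∃ (λ u → u ∈ interleavings xs (y ∷ ys) × l ≡ x ∷ u) →
                  ∃ (λ v → v ∈ interleavings (x ∷ xs) ys × l ≡ y ∷ v) → x ∈ y ∷ ys
  heads (_ , _ , refl) (_ , _ , refl) = here refl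

interleavings-∷ˡ : ∀ {x} (xs ys : List A) {l} → l ∈ interleavings xs ys → x ∷ l ∈ interleavings (x ∷ xs) ys
interleavings-∷ˡ [] [] (here refl) = here refl
interleavings-∷ˡ (_ ∷ _) [] (here refl) = here refl
interleavings-∷ˡ xs (y ∷ ys) l∈ = ∈P.∈-++⁺ˡ (∈P.∈-map⁺ _ l∈)

interleavings-∷ʳ : ∀ {y} (xs ys : List A) {l} → l ∈ interleavings xs ys → y ∷ l ∈ interleavings xs (y ∷ ys)
interleavings-∷ʳ [] ys (here refl) = here refl
interleavings-∷ʳ (x ∷ xs) ys l∈ = ∈P.∈-++⁺ʳ _ (∈P.∈-map⁺ _ l∈)

module _ (f : A → C) (g : B → C) where

  Interleaves : List A → List B → List C → Set
  Interleaves = Interleaving (λ x z → f x ≡ z) (λ y z → g y ≡ z)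

  ∈-interleavings⁺ : ∀ {p q l} → Interleaves p q l → l ∈ interleavings (map f p) (map g q)
  ∈-interleavings⁺ [] = here refl
  ∈-interleavings⁺ {p = _ ∷ p} {q} (refl ∷ˡ i) = interleavings-∷ˡ (map f p) (map g q) (∈-interleavings⁺ i)
  ∈-interleavings⁺ {p = p} {_ ∷ q} (refl ∷ʳ i) = interleavings-∷ʳ (map f p) (map g q) (∈-interleavings⁺ i)

  ∈-interleavings⁻ : ∀ p q {l} → l ∈ interleavings (map f p) (map g q) → Interleaves p q l
  ∈-interleavings⁻ [] q (here refl) = only-right q
    where
    only-right : ∀ q → Interleaves [] q (map g q)
    only-right [] = []
    only-right (y ∷ q) = refl ∷ʳ only-right q
  ∈-interleavings⁻ (x ∷ p) [] (here refl) = only-left (x ∷ p)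
    where
    only-left : ∀ p → Interleaves p [] (map f p)
    only-left [] = []
    only-left (x ∷ p) = refl ∷ˡ only-left p
  ∈-interleavings⁻ (x ∷ p) (y ∷ q) l∈ with ∈P.∈-++⁻ (map (f x ∷_) (interleavings (map f p) (map g (y ∷ q)))) l∈
  ... | inj₁ l∈ˡ with ∈P.∈-map⁻ (f x ∷_) l∈ˡ
  ...   | _ , u∈ , refl = refl ∷ˡ ∈-interleavings⁻ p (y ∷ q) u∈
  ∈-interleavings⁻ (x ∷ p) (y ∷ q) l∈ | inj₂ l∈ʳ with ∈P.∈-map⁻ (g y ∷_) l∈ʳ
  ...   | _ , u∈ , refl = refl ∷ʳ ∈-interleavings⁻ (x ∷ p) q u∈

  interleaves-↭ : ∀ {p q l} → Interleaves p q l → l ↭ map f p ++ map g q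
  interleaves-↭ {l = l} i =
    subst (_↭ _) (ListP.map-id l) (PropInterleaving.toPermutation (InterleavingP.map⁺ f g (λ z → z) i))

  interleaves-injective : Injective _≡_ _≡_ f → Injective _≡_ _≡_ g → (∀ {x y} → f x ≢ g y) →
    ∀ {p p′ q q′ l} → Interleaves p q l → Interleaves p′ q′ l → p ≡ p′ × q ≡ q′
  interleaves-injective f-inj g-inj f≢g = go
    where
    go : ∀ {p p′ q q′ l} → Interleaves p q l → Interleaves p′ q′ l → p ≡ p′ × q ≡ q′
    go [] [] = refl , refl
    go (e ∷ˡ i) (e′ ∷ˡ i′) with go i i′
    ... | refl , refl = cong (_∷ _) (f-inj (trans e (sym e′))) , refl
    go (e ∷ˡ i) (e′ ∷ʳ i′) = ⊥-elim (f≢g (trans e (sym e′)))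
    go (e ∷ʳ i) (e′ ∷ˡ i′) = ⊥-elim (f≢g (trans e′ (sym e)))
    go (e ∷ʳ i) (e′ ∷ʳ i′) with go i i′
    ... | refl , refl = refl , cong (_∷ _) (g-inj (trans e (sym e′)))

-- Subsets and their enumerations

∈-elems : {T : Subset m} {x : Fin m} → x ∈ elems T ⇔ x ∈ₛ T
∈-elems {m} {T} {x} = mk⇔
  (λ x∈ → VecP.lookup⇒[]= x T (to T-≡ (proj₂ (∈P.∈-filter⁻ _ {xs = List.allFin m} x∈))))
  (λ x∈T → ∈P.∈-filter⁺ _ (∈P.∈-allFin x) (from T-≡ (VecP.[]=⇒lookup x∈T)))

elems-unique : (T : Subset m) → Unique (elems T)
elems-unique {m} T = UniqueP.filter⁺ _ (UniqueP.allFin⁺ m)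

∈-subsetsOf⁻ : (T : Subset m) {A : Subset m} → A ∈ subsetsOf T → A ⊆ₛ T
∈-subsetsOf⁻ [] {[]} _ ()
∈-subsetsOf⁻ (false ∷ T) A∈ with ∈P.∈-map⁻ (false ∷_) A∈
... | _ , A′∈ , refl = SubsetP.out⊆ (∈-subsetsOf⁻ T A′∈)
∈-subsetsOf⁻ (true ∷ T) A∈ with ∈P.∈-++⁻ (map (false ∷_) (subsetsOf T)) A∈
... | inj₁ A∈ˡ with ∈P.∈-map⁻ (false ∷_) A∈ˡ
...   | _ , A′∈ , refl = SubsetP.out⊆ (∈-subsetsOf⁻ T A′∈)
∈-subsetsOf⁻ (true ∷ T) A∈ | inj₂ A∈ʳ with ∈P.∈-map⁻ (true ∷_) A∈ʳ
...   | _ , A′∈ , refl = SubsetP.s⊆s (∈-subsetsOf⁻ T A′∈)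

∈-subsetsOf⁺ : (T A : Subset m) → A ⊆ₛ T → A ∈ subsetsOf T
∈-subsetsOf⁺ [] [] _ = here refl
∈-subsetsOf⁺ (false ∷ T) (false ∷ A) A⊆T = ∈P.∈-map⁺ (false ∷_) (∈-subsetsOf⁺ T A (SubsetP.drop-∷-⊆ A⊆T))
∈-subsetsOf⁺ (false ∷ T) (true ∷ A) A⊆T with A⊆T here
... | ()
∈-subsetsOf⁺ (true ∷ T) (false ∷ A) A⊆T =
  ∈P.∈-++⁺ˡ (∈P.∈-map⁺ (false ∷_) (∈-subsetsOf⁺ T A (SubsetP.drop-∷-⊆ A⊆T)))
∈-subsetsOf⁺ (true ∷ T) (true ∷ A) A⊆T =
  ∈P.∈-++⁺ʳ (map (false ∷_) (subsetsOf T)) (∈P.∈-map⁺ (true ∷_) (∈-subsetsOf⁺ T A (SubsetP.drop-∷-⊆ A⊆T)))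

subsetsOf-unique : (T : Subset m) → Unique (subsetsOf T)
subsetsOf-unique [] = [] ∷ []
subsetsOf-unique (false ∷ T) = UniqueP.map⁺ VecP.∷-injectiveʳ (subsetsOf-unique T)
subsetsOf-unique (true ∷ T) =
  UniqueP.++⁺ (UniqueP.map⁺ VecP.∷-injectiveʳ (subsetsOf-unique T)) (UniqueP.map⁺ VecP.∷-injectiveʳ (subsetsOf-unique T))
    λ (u , v) → heads (∈P.∈-map⁻ (false ∷_) u) (∈P.∈-map⁻ (true ∷_) v)
  where
  heads : ∀ {A} → ∃ (λ B → B ∈ subsetsOf T × A ≡ false ∷ B) → ∃ (λ B → B ∈ subsetsOf T × A ≡ true ∷ B) → _
  heads (_ , _ , refl) (_ , _ , ())

∈-─⁻ : {p q : Subset m} {x : Fin m} → x ∈ₛ p ─ q → x ∈ₛ p × x ∉ₛ q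
∈-─⁻ {p = p} {q} x∈ = SubsetP.p─q⊆p p q x∈ , ∉q p q x∈
  where
  ∉q : ∀ {m} (p q : Subset m) {x} → x ∈ₛ p ─ q → x ∉ₛ q
  ∉q (true ∷ p) (true ∷ q) () here
  ∉q (false ∷ p) (true ∷ q) () here
  ∉q (_ ∷ p) (_ ∷ q) (there x∈) (there x∈q) = ∉q p q x∈ x∈q

∣-∣-remove : {T : Subset m} {x : Fin m} → x ∈ₛ T → suc ∣ T - x ∣ ≡ ∣ T ∣
∣-∣-remove {T = true ∷ T} {zero} here = cong (λ S → suc ∣ S ∣) (SubsetP.p─⊥≡p T)
∣-∣-remove {T = true ∷ T} {suc x} (there x∈) = cong suc (∣-∣-remove x∈)
∣-∣-remove {T = false ∷ T} {suc x} (there x∈) = ∣-∣-remove x∈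

∣∣≡0⇒∉ : {T : Subset m} → ∣ T ∣ ≡ 0 → ∀ {x} → x ∉ₛ T
∣∣≡0⇒∉ {T = false ∷ T} e (there x∈) = ∣∣≡0⇒∉ e x∈

∣∣≡suc⇒nonempty : {T : Subset m} {k : ℕ} → ∣ T ∣ ≡ suc k → Nonempty T
∣∣≡suc⇒nonempty {T = true ∷ T} e = zero , here
∣∣≡suc⇒nonempty {T = false ∷ T} e with ∣∣≡suc⇒nonempty e
... | x , x∈ = suc x , there x∈

record Enumerates (T : Subset m) (l : List (Fin m)) : Set where
  field
    unique  : Unique l
    members : ∀ {z} → z ∈ l ⇔ z ∈ₛ T
open Enumerates

enumerates-∷ : {T : Subset m} {x : Fin m} {l : List (Fin m)} → x ∈ₛ T → Enumerates (T - x) l → Enumerates T (x ∷ l)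
enumerates-∷ {T = T} {x} {l} x∈T e = record
  { unique  = All.tabulate (λ z∈l x≡z → SubsetP.x∉⁅y⁆⇒x≢y (proj₂ (∈-─⁻ (to (members e) z∈l))) (sym x≡z)) ∷ unique e
  ; members = mk⇔ (λ { (here refl) → x∈T ; (there z∈l) → proj₁ (∈-─⁻ (to (members e) z∈l)) }) from′
  }
  where
  from′ : ∀ {z} → z ∈ₛ T → z ∈ x ∷ l
  from′ {z} z∈T with z Fin.≟ x
  ... | yes refl = here refl
  ... | no z≢x = there (from (members e) (SubsetP.x∈p∧x≢y⇒x∈p-y z∈T z≢x))

enumerates-∷⁻ : {T : Subset m} {x : Fin m} {l : List (Fin m)} → Enumerates T (x ∷ l) → x ∈ₛ T × Enumerates (T - x) l
enumerates-∷⁻ {T = T} {x} {l} e with unique e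
... | x∉l ∷ l! = to (members e) (here refl) , record
  { unique  = l!
  ; members = mk⇔
      (λ z∈l → SubsetP.x∈p∧x≢y⇒x∈p-y (to (members e) (there z∈l)) (λ z≡x → All.lookup x∉l z∈l (sym z≡x)))
      (λ z∈T-x → drop-head (from (members e) (proj₁ (∈-─⁻ z∈T-x)))
                   (SubsetP.x∉⁅y⁆⇒x≢y (proj₂ (∈-─⁻ z∈T-x))))
  }
  where
  drop-head : ∀ {z} → z ∈ x ∷ l → z ≢ x → z ∈ l
  drop-head (here z≡x) z≢x = ⊥-elim (z≢x z≡x)
  drop-head (there z∈l) _ = z∈l

orderings : ℕ → Subset m → List (List (Fin m))
orderings zero T = [] ∷ []
orderings (suc k) T = concatMap (λ x → map (x ∷_) (orderings k (T - x))) (elems T)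

∈-orderings⁻ : ∀ k (T : Subset m) {l} → k ≡ ∣ T ∣ → l ∈ orderings k T → Enumerates T l
∈-orderings⁻ zero T k≡ (here refl) = record
  { unique = [] ; members = mk⇔ (λ ()) (λ z∈T → ⊥-elim (∣∣≡0⇒∉ (sym k≡) z∈T)) }
∈-orderings⁻ (suc k) T k≡ l∈ with find (∈P.∈-concatMap⁻ _ {xs = elems T} l∈)
... | x , x∈ , l∈′ with ∈P.∈-map⁻ (x ∷_) l∈′
...   | l′ , l′∈ , refl =
  enumerates-∷ x∈T (∈-orderings⁻ k (T - x) (ℕP.suc-injective (trans k≡ (sym (∣-∣-remove x∈T)))) l′∈)
  where x∈T = to ∈-elems x∈

∈-orderings⁺ : ∀ k (T : Subset m) {l} → k ≡ ∣ T ∣ → Enumerates T l → l ∈ orderings k T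
∈-orderings⁺ zero T {[]} k≡ e = here refl
∈-orderings⁺ zero T {z ∷ l} k≡ e = ⊥-elim (∣∣≡0⇒∉ (sym k≡) (to (members e) (here refl)))
∈-orderings⁺ (suc k) T {[]} k≡ e with ∣∣≡suc⇒nonempty (sym k≡)
... | z , z∈T with from (members e) z∈T
...   | ()
∈-orderings⁺ (suc k) T {x ∷ l} k≡ e with enumerates-∷⁻ e
... | x∈T , e′ = ∈P.∈-concatMap⁺ _ (lose (from ∈-elems x∈T)
      (∈P.∈-map⁺ (x ∷_) (∈-orderings⁺ k (T - x) (ℕP.suc-injective (trans k≡ (sym (∣-∣-remove x∈T)))) e′)))

orderings-unique : ∀ k (T : Subset m) → Unique (orderings k T)
orderings-unique zero T = [] ∷ []
orderings-unique (suc k) T =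
  Unique-concatMap⁺ (elems-unique T) (λ x → UniqueP.map⁺ ListP.∷-injectiveʳ (orderings-unique k (T - x)))
    λ u v → heads (∈P.∈-map⁻ _ u) (∈P.∈-map⁻ _ v)
  where
  heads : ∀ {x x′ l} {L L′ : List (List (Fin _))} →
    ∃ (λ u → u ∈ L × l ≡ x ∷ u) → ∃ (λ v → v ∈ L′ × l ≡ x′ ∷ v) → x ≡ x′
  heads (_ , _ , refl) (_ , _ , refl) = refl

enumerations : Subset m → List (List (Fin m))
enumerations T = orderings ∣ T ∣ T

∈-enumerations⁻ : {T : Subset m} {l : List (Fin m)} → l ∈ enumerations T → Enumerates T l
∈-enumerations⁻ {T = T} = ∈-orderings⁻ ∣ T ∣ T refl

∈-enumerations⁺ : {T : Subset m} {l : List (Fin m)} → Enumerates T l → l ∈ enumerations T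
∈-enumerations⁺ {T = T} = ∈-orderings⁺ ∣ T ∣ T refl

enumerations-unique : (T : Subset m) → Unique (enumerations T)
enumerations-unique T = orderings-unique ∣ T ∣ T

enumerations-bag : (T : Subset m) {L : List (List (Fin m))} → Unique L → (∀ {l} → l ∈ L ⇔ Enumerates T l) →
  enumerations T ∼[ bag ] L
enumerations-bag T L! L≡ = unique∧set⇒bag (enumerations-unique T) L!
  (mk⇔ (λ l∈ → from L≡ (∈-enumerations⁻ l∈)) (λ l∈ → ∈-enumerations⁺ (to L≡ l∈)))

enumerates-↭ : {T : Subset m} {l l′ : List (Fin m)} → l ↭ l′ → Enumerates T l → Enumerates T l′
enumerates-↭ l↭l′ e = record
  { unique  = Unique-resp-↭ l↭l′ (unique e)
  ; members = mk⇔ (to (members e) ∘ PermP.∈-resp-↭ (↭-sym l↭l′)) (PermP.∈-resp-↭ l↭l′ ∘ from (members e))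
  }

-- Maximal chains as enumerations

addAll : Subset m → List (Fin m) → Subset m
addAll = foldl (λ S x → S ∪ ⁅ x ⁆)

∈-∪⁅⁆ : {S : Subset m} {x z : Fin m} → z ∈ₛ S ∪ ⁅ x ⁆ ⇔ (z ∈ₛ S ⊎ z ≡ x)
∈-∪⁅⁆ {S = S} {x} = mk⇔
  (λ z∈ → [ inj₁ , (λ z∈x → inj₂ (SubsetP.x∈⁅y⁆⇒x≡y x z∈x)) ]′ (SubsetP.x∈p∪q⁻ S ⁅ x ⁆ z∈))
  (λ { (inj₁ z∈S) → SubsetP.x∈p∪q⁺ (inj₁ z∈S) ; (inj₂ refl) → SubsetP.x∈p∪q⁺ (inj₂ (SubsetP.x∈⁅x⁆ x)) })

∈-addAll : (S : Subset m) (l : List (Fin m)) {z : Fin m} → z ∈ₛ addAll S l ⇔ (z ∈ₛ S ⊎ z ∈ l)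
∈-addAll S [] = mk⇔ inj₁ [ (λ z∈S → z∈S) , (λ ()) ]′
∈-addAll S (x ∷ l) = mk⇔ (unshift ∘ to (∈-addAll (S ∪ ⁅ x ⁆) l)) (from (∈-addAll (S ∪ ⁅ x ⁆) l) ∘ shift)
  where
  unshift : ∀ {z} → z ∈ₛ S ∪ ⁅ x ⁆ ⊎ z ∈ l → z ∈ₛ S ⊎ z ∈ x ∷ l
  unshift (inj₁ z∈S∪x) = Sum.map₂ here (to ∈-∪⁅⁆ z∈S∪x)
  unshift (inj₂ z∈l) = inj₂ (there z∈l)
  shift : ∀ {z} → z ∈ₛ S ⊎ z ∈ x ∷ l → z ∈ₛ S ∪ ⁅ x ⁆ ⊎ z ∈ l
  shift (inj₁ z∈S) = inj₁ (from ∈-∪⁅⁆ (inj₁ z∈S))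
  shift (inj₂ (here z≡x)) = inj₁ (from ∈-∪⁅⁆ (inj₂ z≡x))
  shift (inj₂ (there z∈l)) = inj₂ z∈l

addAll-enumeration : {T : Subset m} {l : List (Fin m)} → Enumerates T l → addAll ∅ l ≡ T
addAll-enumeration {l = l} e = SubsetP.⊆-antisym
  (λ z∈ → [ (λ z∈∅ → ⊥-elim (SubsetP.∉⊥ z∈∅)) , to (members e) ]′ (to (∈-addAll ∅ l) z∈))
  (λ z∈T → from (∈-addAll ∅ l) (inj₂ (from (members e) z∈T)))

∪⁅⁆-remove : {A : Subset m} {x : Fin m} → x ∉ₛ A → (A ∪ ⁅ x ⁆) - x ≡ A
∪⁅⁆-remove {A = A} {x} x∉A = SubsetP.⊆-antisym
  (λ z∈ → let z∈A∪x , z∉x = ∈-─⁻ z∈ in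
          [ (λ z∈A → z∈A) , (λ z≡x → ⊥-elim (SubsetP.x∉⁅y⁆⇒x≢y z∉x z≡x)) ]′ (to ∈-∪⁅⁆ z∈A∪x))
  (λ z∈A → SubsetP.x∈p∧x≢y⇒x∈p-y (from ∈-∪⁅⁆ (inj₁ z∈A)) (λ { refl → x∉A z∈A }))

gains : (Subset m → ℕ) → Subset m → List (Fin m) → List ℕ
gains r S [] = []
gains r S (x ∷ l) = (r (S ∪ ⁅ x ⁆) ∸ r S) ∷ gains r (S ∪ ⁅ x ⁆) l

gains-++ : (r : Subset m → ℕ) (S : Subset m) (p q : List (Fin m)) →
  gains r S (p ++ q) ≡ gains r S p ++ gains r (addAll S p) q
gains-++ r S [] q = refl
gains-++ r S (x ∷ p) q = cong (_ ∷_) (gains-++ r (S ∪ ⁅ x ⁆) p q)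

removalChain : Subset m → List (Fin m) → List (Subset m)
removalChain T [] = T ∷ []
removalChain T (x ∷ l) = removalChain (T - x) l ++ T ∷ []

maxChains≡removalChains : ∀ k (T : Subset m) → maxChains k T ≡ map (removalChain T) (orderings k T)
maxChains≡removalChains ℕ.zero T = refl
maxChains≡removalChains (suc k) T = begin
  concatMap (λ x → map (_++ T ∷ []) (maxChains k (T - x))) (elems T)
    ≡⟨ ListP.concatMap-cong (λ x → cong (map (_++ T ∷ [])) (maxChains≡removalChains k (T - x))) (elems T) ⟩
  concatMap (λ x → map (_++ T ∷ []) (map (removalChain (T - x)) (orderings k (T - x)))) (elems T)
    ≡⟨ ListP.concatMap-cong (λ x → trans (sym (ListP.map-∘ (orderings k (T - x)))) (ListP.map-∘ (orderings k (T - x))))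
                            (elems T) ⟩
  concatMap (λ x → map (removalChain T) (map (x ∷_) (orderings k (T - x)))) (elems T)
    ≡⟨ ListP.map-concatMap (removalChain T) (λ x → map (x ∷_) (orderings k (T - x))) (elems T) ⟨
  map (removalChain T) (orderings (suc k) T) ∎
  where open ≡-Reasoning

rankSeq-snoc : (r : Subset m → ℕ) (c : List (Subset m)) (S T : Subset m) →
  rankSeq r ((c ++ S ∷ []) ++ T ∷ []) ≡ rankSeq r (c ++ S ∷ []) ++ (r T ∸ r S) ∷ []
rankSeq-snoc r [] S T = refl
rankSeq-snoc r (A ∷ []) S T = refl
rankSeq-snoc r (A ∷ B ∷ c) S T = cong ((r B ∸ r A) ∷_) (rankSeq-snoc r (B ∷ c) S T)

rankSeq-removalChain-∷ : (r : Subset m → ℕ) (T : Subset m) (x : Fin m) (l : List (Fin m)) →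
  rankSeq r (removalChain T (x ∷ l)) ≡ rankSeq r (removalChain (T - x) l) ++ (r T ∸ r (T - x)) ∷ []
rankSeq-removalChain-∷ r T x [] = refl
rankSeq-removalChain-∷ r T x (y ∷ l) = rankSeq-snoc r (removalChain (T - x - y) l) (T - x) T

-- Removing the elements of l from the top is adding those of reverse l from the bottom.
rankSeq-removalChain : (r : Subset m → ℕ) (S : Subset m) (l : List (Fin m)) →
  Unique l → (∀ {z} → z ∈ l → z ∉ₛ S) →
  rankSeq r (removalChain (addAll S (reverse l)) l) ≡ gains r S (reverse l)
rankSeq-removalChain r S [] _ _ = refl
rankSeq-removalChain r S (x ∷ l) (x∉l ∷ l!) disj = begin
  rankSeq r (removalChain (addAll S (reverse (x ∷ l))) (x ∷ l))
    ≡⟨ cong (λ T → rankSeq r (removalChain T (x ∷ l))) addAll-reverse-∷ ⟩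
  rankSeq r (removalChain (T′ ∪ ⁅ x ⁆) (x ∷ l))
    ≡⟨ rankSeq-removalChain-∷ r (T′ ∪ ⁅ x ⁆) x l ⟩
  rankSeq r (removalChain ((T′ ∪ ⁅ x ⁆) - x) l) ++ (r (T′ ∪ ⁅ x ⁆) ∸ r ((T′ ∪ ⁅ x ⁆) - x)) ∷ []
    ≡⟨ cong (λ T → rankSeq r (removalChain T l) ++ (r (T′ ∪ ⁅ x ⁆) ∸ r T) ∷ []) (∪⁅⁆-remove x∉T′) ⟩
  rankSeq r (removalChain T′ l) ++ (r (T′ ∪ ⁅ x ⁆) ∸ r T′) ∷ []
    ≡⟨ cong (_++ (r (T′ ∪ ⁅ x ⁆) ∸ r T′) ∷ []) (rankSeq-removalChain r S l l! (disj ∘ there)) ⟩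
  gains r S (reverse l) ++ gains r T′ (x ∷ [])
    ≡⟨ gains-++ r S (reverse l) (x ∷ []) ⟨
  gains r S (reverse l ++ x ∷ [])
    ≡⟨ cong (gains r S) (ListP.unfold-reverse x l) ⟨
  gains r S (reverse (x ∷ l)) ∎
  where
  open ≡-Reasoning
  T′ = addAll S (reverse l)
  addAll-reverse-∷ : addAll S (reverse (x ∷ l)) ≡ T′ ∪ ⁅ x ⁆
  addAll-reverse-∷ = trans (cong (addAll S) (ListP.unfold-reverse x l)) (ListP.foldl-++ _ S (reverse l) (x ∷ []))
  x∉T′ : x ∉ₛ T′
  x∉T′ x∈ = [ disj (here refl) , (λ x∈l′ → All.lookup x∉l (PermP.∈-resp-↭ (PermP.↭-reverse l) x∈l′) refl) ]′
              (to (∈-addAll S (reverse l)) x∈)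

enumerates-reverse : {T : Subset m} {l : List (Fin m)} → Enumerates T l → Enumerates T (reverse l)
enumerates-reverse {l = l} = enumerates-↭ (↭-sym (PermP.↭-reverse l))

enumerations-reverse : (T : Subset m) → enumerations T ∼[ bag ] map reverse (enumerations T)
enumerations-reverse T = enumerations-bag T (UniqueP.map⁺ ListP.reverse-injective (enumerations-unique T)) (mk⇔ to′ from′)
  where
  to′ : ∀ {l} → l ∈ map reverse (enumerations T) → Enumerates T l
  to′ l∈ with ∈P.∈-map⁻ reverse l∈
  ... | l′ , l′∈ , refl = enumerates-reverse (∈-enumerations⁻ l′∈)
  from′ : ∀ {l} → Enumerates T l → l ∈ map reverse (enumerations T)
  from′ {l} e = subst (_∈ _) (ListP.reverse-involutive l) (∈P.∈-map⁺ reverse (∈-enumerations⁺ (enumerates-reverse e)))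

rankSeq-maxChain : (r : Subset m → ℕ) {T : Subset m} {l : List (Fin m)} → Enumerates T l →
  rankSeq r (removalChain T l) ≡ gains r ∅ (reverse l)
rankSeq-maxChain r {l = l} e =
  subst (λ T → rankSeq r (removalChain T l) ≡ gains r ∅ (reverse l)) (addAll-enumeration (enumerates-reverse e))
    (rankSeq-removalChain r ∅ l (unique e) (λ _ → SubsetP.∉⊥))

ones : List Comp → QSym
ones = map (1ℚ ,_)

rankCompositions : (Subset m → ℕ) → Subset m → List Comp
rankCompositions r T = map (map suc ∘ gains r ∅) (enumerations T)

𝒢₀-enumerations : (X : SetFn) → 𝒢₀ X ∼[ bag ] ones (rankCompositions (rk X) (ground X))
𝒢₀-enumerations X = begin
  𝒢₀ X
    ≡⟨ concatMap-U (maxChains ∣ T ∣ T) ⟩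
  ones (map (map suc ∘ rankSeq r) (maxChains ∣ T ∣ T))
    ≡⟨ cong (ones ∘ map (map suc ∘ rankSeq r)) (maxChains≡removalChains ∣ T ∣ T) ⟩
  ones (map (map suc ∘ rankSeq r) (map (removalChain T) O))
    ≡⟨ cong ones (trans (sym (ListP.map-∘ O)) (ListP.map-cong-local (All.tabulate chain≡))) ⟩
  ones (map (map suc ∘ gains r ∅ ∘ reverse) O)
    ≡⟨ cong ones (ListP.map-∘ O) ⟩
  ones (map (map suc ∘ gains r ∅) (map reverse O))
    ≈⟨ map-cong (λ _ → refl) (map-cong (λ _ → refl) (Bag.sym (enumerations-reverse T))) ⟩
  ones (rankCompositions r T) ∎
  where
  r = rk X
  T = ground X
  O = enumerations T
  open import Relation.Binary.Reasoning.Setoid ([ bag ]-Equality (ℚ × Comp))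
  concatMap-U : ∀ cs → concatMap (U ∘ rankSeq r) cs ≡ ones (map (map suc ∘ rankSeq r) cs)
  concatMap-U [] = refl
  concatMap-U (c ∷ cs) = cong (_ ∷_) (concatMap-U cs)
  chain≡ : ∀ {l} → l ∈ O → map suc (rankSeq r (removalChain T l)) ≡ map suc (gains r ∅ (reverse l))
  chain≡ l∈ = cong (map suc) (rankSeq-maxChain r (∈-enumerations⁻ l∈))

-- Direct sums

shuffleProduct : List Comp → List Comp → List Comp
shuffleProduct L M = concatMap (λ α → concatMap (shuffles α) M) L

take-++ : ∀ {A : Set} {m n} (xs : Vec A m) (ys : Vec A n) → Vec.take m (xs Vec.++ ys) ≡ xs
take-++ [] ys = refl
take-++ (x ∷ xs) ys = cong (x ∷_) (take-++ xs ys)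

drop-++ : ∀ {A : Set} {m n} (xs : Vec A m) (ys : Vec A n) → Vec.drop m (xs Vec.++ ys) ≡ ys
drop-++ [] ys = refl
drop-++ (x ∷ xs) ys = drop-++ xs ys

∅-++ : ∀ m n → ∅ {m + n} ≡ ∅ {m} Vec.++ ∅ {n}
∅-++ ℕ.zero n = refl
∅-++ (suc m) n = cong (Bool.false ∷_) (∅-++ m n)

⁅↑ˡ⁆ : ∀ {m} n (x : Fin m) → ⁅ x ↑ˡ n ⁆ ≡ ⁅ x ⁆ Vec.++ ∅ {n}
⁅↑ˡ⁆ {suc m} n Fin.zero = cong (Bool.true ∷_) (∅-++ m n)
⁅↑ˡ⁆ n (Fin.suc x) = cong (Bool.false ∷_) (⁅↑ˡ⁆ n x)

⁅↑ʳ⁆ : ∀ m {n} (y : Fin n) → ⁅ m ↑ʳ y ⁆ ≡ ∅ {m} Vec.++ ⁅ y ⁆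
⁅↑ʳ⁆ ℕ.zero y = refl
⁅↑ʳ⁆ (suc m) y = cong (Bool.false ∷_) (⁅↑ʳ⁆ m y)

∪-⁅↑ˡ⁆ : ∀ {m n} (A : Subset m) (B : Subset n) x → (A Vec.++ B) ∪ ⁅ x ↑ˡ n ⁆ ≡ (A ∪ ⁅ x ⁆) Vec.++ B
∪-⁅↑ˡ⁆ {n = n} A B x = begin
  (A Vec.++ B) ∪ ⁅ x ↑ˡ n ⁆      ≡⟨ cong ((A Vec.++ B) ∪_) (⁅↑ˡ⁆ n x) ⟩
  (A Vec.++ B) ∪ (⁅ x ⁆ Vec.++ ∅) ≡⟨ VecP.zipWith-++ _∨_ A B ⁅ x ⁆ ∅ ⟩
  (A ∪ ⁅ x ⁆) Vec.++ (B ∪ ∅)      ≡⟨ cong ((A ∪ ⁅ x ⁆) Vec.++_) (SubsetP.∪-identityʳ B) ⟩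
  (A ∪ ⁅ x ⁆) Vec.++ B           ∎
  where open ≡-Reasoning

∪-⁅↑ʳ⁆ : ∀ {m n} (A : Subset m) (B : Subset n) y → (A Vec.++ B) ∪ ⁅ m ↑ʳ y ⁆ ≡ A Vec.++ (B ∪ ⁅ y ⁆)
∪-⁅↑ʳ⁆ {m} A B y = begin
  (A Vec.++ B) ∪ ⁅ m ↑ʳ y ⁆      ≡⟨ cong ((A Vec.++ B) ∪_) (⁅↑ʳ⁆ m y) ⟩
  (A Vec.++ B) ∪ (∅ Vec.++ ⁅ y ⁆) ≡⟨ VecP.zipWith-++ _∨_ A B ∅ ⁅ y ⁆ ⟩
  (A ∪ ∅) Vec.++ (B ∪ ⁅ y ⁆)      ≡⟨ cong (Vec._++ (B ∪ ⁅ y ⁆)) (SubsetP.∪-identityʳ A) ⟩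
  A Vec.++ (B ∪ ⁅ y ⁆)           ∎
  where open ≡-Reasoning

module DirectSum {m n : ℕ} where

  inl : Fin m → Fin (m + n)
  inl x = x ↑ˡ n

  inr : Fin n → Fin (m + n)
  inr y = m ↑ʳ y

  inl-injective : ∀ {x x′} → inl x ≡ inl x′ → x ≡ x′
  inl-injective = FinP.↑ˡ-injective n _ _

  inr-injective : ∀ {y y′} → inr y ≡ inr y′ → y ≡ y′
  inr-injective = FinP.↑ʳ-injective m _ _

  inl≢inr : ∀ {x y} → inl x ≢ inr y
  inl≢inr {x} {y} e with trans (sym (FinP.splitAt-↑ˡ m x n)) (trans (cong (splitAt m) e) (FinP.splitAt-↑ʳ m n y))
  ... | ()

  unshuffle : (l : List (Fin (m + n))) → ∃₂ λ p q → Interleaves inl inr p q l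
  unshuffle [] = [] , [] , []
  unshuffle (z ∷ l) with splitAt m z in eq | unshuffle l
  ... | inj₁ x | p , q , i = x ∷ p , q , FinP.splitAt⁻¹-↑ˡ eq ∷ˡ i
  ... | inj₂ y | p , q , i = p , y ∷ q , FinP.splitAt⁻¹-↑ʳ eq ∷ʳ i

  images-disjoint : ∀ p q → Disjoint (map inl p) (map inr q)
  images-disjoint p q (u , v) with ∈P.∈-map⁻ inl u | ∈P.∈-map⁻ inr v
  ... | _ , _ , refl | _ , _ , e = inl≢inr e

  inl-∈ : ∀ {x p q} → inl x ∈ map inl p ++ map inr q → x ∈ p
  inl-∈ {p = p} x∈ with ∈P.∈-++⁻ (map inl p) x∈
  ... | inj₁ x∈ˡ with ∈P.∈-map⁻ inl x∈ˡ
  ...   | _ , x′∈ , e = subst (_∈ p) (sym (inl-injective e)) x′∈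
  inl-∈ {p = p} x∈ | inj₂ x∈ʳ with ∈P.∈-map⁻ inr x∈ʳ
  ...   | _ , _ , e = ⊥-elim (inl≢inr e)

  inr-∈ : ∀ {y p q} → inr y ∈ map inl p ++ map inr q → y ∈ q
  inr-∈ {p = p} {q} y∈ with ∈P.∈-++⁻ (map inl p) y∈
  ... | inj₂ y∈ʳ with ∈P.∈-map⁻ inr y∈ʳ
  ...   | _ , y′∈ , e = subst (_∈ q) (sym (inr-injective e)) y′∈
  inr-∈ {p = p} y∈ | inj₁ y∈ˡ with ∈P.∈-map⁻ inl y∈ˡ
  ...   | _ , _ , e = ⊥-elim (inl≢inr (sym e))

  module _ (TX : Subset m) (TY : Subset n) where

    ∈-inl : ∀ {x} → inl x ∈ₛ TX Vec.++ TY ⇔ x ∈ₛ TX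
    ∈-inl {x} = mk⇔
      (λ x∈ → VecP.lookup⇒[]= x TX (trans (sym (VecP.lookup-++ˡ TX TY x)) (VecP.[]=⇒lookup x∈)))
      (λ x∈ → VecP.lookup⇒[]= (inl x) (TX Vec.++ TY) (trans (VecP.lookup-++ˡ TX TY x) (VecP.[]=⇒lookup x∈)))

    ∈-inr : ∀ {y} → inr y ∈ₛ TX Vec.++ TY ⇔ y ∈ₛ TY
    ∈-inr {y} = mk⇔
      (λ y∈ → VecP.lookup⇒[]= y TY (trans (sym (VecP.lookup-++ʳ TX TY y)) (VecP.[]=⇒lookup y∈)))
      (λ y∈ → VecP.lookup⇒[]= (inr y) (TX Vec.++ TY) (trans (VecP.lookup-++ʳ TX TY y) (VecP.[]=⇒lookup y∈)))

    enumerates-⊕ : ∀ {p q} → Enumerates TX p → Enumerates TY q → Enumerates (TX Vec.++ TY) (map inl p ++ map inr q)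
    enumerates-⊕ {p} {q} ep eq = record
      { unique  = UniqueP.++⁺ (UniqueP.map⁺ inl-injective (unique ep)) (UniqueP.map⁺ inr-injective (unique eq))
                    (images-disjoint p q)
      ; members = mk⇔ to′ from′
      }
      where
      to′ : ∀ {z} → z ∈ map inl p ++ map inr q → z ∈ₛ TX Vec.++ TY
      to′ z∈ with ∈P.∈-++⁻ (map inl p) z∈
      ... | inj₁ z∈ˡ with ∈P.∈-map⁻ inl z∈ˡ
      ...   | x , x∈p , refl = from ∈-inl (to (members ep) x∈p)
      to′ z∈ | inj₂ z∈ʳ with ∈P.∈-map⁻ inr z∈ʳ
      ...   | y , y∈q , refl = from ∈-inr (to (members eq) y∈q)
      from′ : ∀ {z} → z ∈ₛ TX Vec.++ TY → z ∈ map inl p ++ map inr q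
      from′ {z} z∈ with splitAt m z in e
      ... | inj₁ x with FinP.splitAt⁻¹-↑ˡ e
      ...   | refl = ∈P.∈-++⁺ˡ (∈P.∈-map⁺ inl (from (members ep) (to ∈-inl z∈)))
      from′ {z} z∈ | inj₂ y with FinP.splitAt⁻¹-↑ʳ e
      ...   | refl = ∈P.∈-++⁺ʳ (map inl p) (∈P.∈-map⁺ inr (from (members eq) (to ∈-inr z∈)))

    enumerates-⊕⁻ : ∀ {p q} → Enumerates (TX Vec.++ TY) (map inl p ++ map inr q) → Enumerates TX p × Enumerates TY q
    enumerates-⊕⁻ {p} {q} e with Unique-++⁻ (map inl p) (unique e)
    ... | p! , q! , _ =
      record { unique = UniqueP.map⁻ p! ; members = mk⇔ (to ∈-inl ∘ to (members e) ∘ ∈P.∈-++⁺ˡ ∘ ∈P.∈-map⁺ inl)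
                                                         (inl-∈ ∘ from (members e) ∘ from ∈-inl) } ,
      record { unique = UniqueP.map⁻ q! ; members = mk⇔ (to ∈-inr ∘ to (members e) ∘ ∈P.∈-++⁺ʳ (map inl p) ∘ ∈P.∈-map⁺ inr)
                                                         (inr-∈ ∘ from (members e) ∘ from ∈-inr) }

    interleavedEnumerations : List (List (Fin (m + n)))
    interleavedEnumerations =
      concatMap (λ p → concatMap (λ q → interleavings (map inl p) (map inr q)) (enumerations TY)) (enumerations TX)

    ∈-interleavedEnumerations⁻ : ∀ {l} → l ∈ interleavedEnumerations →
      ∃₂ λ p q → p ∈ enumerations TX × q ∈ enumerations TY × Interleaves inl inr p q l
    ∈-interleavedEnumerations⁻ l∈ with find (∈P.∈-concatMap⁻ _ {xs = enumerations TX} l∈)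
    ... | p , p∈ , l∈′ with find (∈P.∈-concatMap⁻ _ {xs = enumerations TY} l∈′)
    ...   | q , q∈ , l∈″ = p , q , p∈ , q∈ , ∈-interleavings⁻ inl inr p q l∈″

    enumerations-⊕ : enumerations (TX Vec.++ TY) ∼[ bag ] interleavedEnumerations
    enumerations-⊕ = enumerations-bag (TX Vec.++ TY) unique′ (mk⇔ to′ from′)
      where
      injective : ∀ {p p′ q q′ l} → Interleaves inl inr p q l → Interleaves inl inr p′ q′ l → p ≡ p′ × q ≡ q′
      injective = interleaves-injective inl inr inl-injective inr-injective inl≢inr
      unique′ : Unique interleavedEnumerations
      unique′ =
        Unique-concatMap⁺ (enumerations-unique TX)
          (λ p → Unique-concatMap⁺ (enumerations-unique TY)
                   (λ q → interleavings-unique (map inl p) (map inr q) (images-disjoint p q))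
                   λ {q} {q′} u v → proj₂ (injective (∈-interleavings⁻ inl inr p q u) (∈-interleavings⁻ inl inr p q′ v)))
          λ {p} {p′} u v → with-q p p′ (find (∈P.∈-concatMap⁻ _ {xs = enumerations TY} u))
                                      (find (∈P.∈-concatMap⁻ _ {xs = enumerations TY} v))
        where
        with-q : ∀ p p′ {l} → ∃ (λ q → q ∈ enumerations TY × l ∈ interleavings (map inl p) (map inr q)) →
                              ∃ (λ q → q ∈ enumerations TY × l ∈ interleavings (map inl p′) (map inr q)) → p ≡ p′
        with-q p p′ (q , _ , u) (q′ , _ , v) = proj₁ (injective (∈-interleavings⁻ inl inr p q u) (∈-interleavings⁻ inl inr p′ q′ v))
      to′ : ∀ {l} → l ∈ interleavedEnumerations → Enumerates (TX Vec.++ TY) l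
      to′ l∈ with ∈-interleavedEnumerations⁻ l∈
      ... | p , q , p∈ , q∈ , i =
        enumerates-↭ (↭-sym (interleaves-↭ inl inr i))
          (enumerates-⊕ (∈-enumerations⁻ p∈) (∈-enumerations⁻ q∈))
      from′ : ∀ {l} → Enumerates (TX Vec.++ TY) l → l ∈ interleavedEnumerations
      from′ {l} e with unshuffle l
      ... | p , q , i with enumerates-⊕⁻ (enumerates-↭ (interleaves-↭ inl inr i) e)
      ...   | ep , eq =
        ∈P.∈-concatMap⁺ (λ p → concatMap (λ q → interleavings (map inl p) (map inr q)) (enumerations TY))
          (lose (∈-enumerations⁺ ep)
            (∈P.∈-concatMap⁺ (λ q → interleavings (map inl p) (map inr q)) (lose (∈-enumerations⁺ eq) (∈-interleavings⁺ inl inr i))))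


  module _ (rX : Subset m → ℕ) (rY : Subset n → ℕ) where

    rsum : Subset (m + n) → ℕ
    rsum C = rX (Vec.take m C) + rY (Vec.drop m C)

    rsum-++ : ∀ A B → rsum (A Vec.++ B) ≡ rX A + rY B
    rsum-++ A B = cong₂ _+_ (cong rX (take-++ A B)) (cong rY (drop-++ A B))

    gains-inl : ∀ A B x l →
      gains rsum (A Vec.++ B) (inl x ∷ l) ≡ (rX (A ∪ ⁅ x ⁆) ∸ rX A) ∷ gains rsum ((A ∪ ⁅ x ⁆) Vec.++ B) l
    gains-inl A B x l rewrite ∪-⁅↑ˡ⁆ A B x | rsum-++ (A ∪ ⁅ x ⁆) B | rsum-++ A B =
      cong (_∷ gains rsum ((A ∪ ⁅ x ⁆) Vec.++ B) l)
        (trans (cong₂ _∸_ (ℕP.+-comm (rX (A ∪ ⁅ x ⁆)) (rY B)) (ℕP.+-comm (rX A) (rY B))) (ℕP.[m+n]∸[m+o]≡n∸o (rY B) _ _))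

    gains-inr : ∀ A B y l →
      gains rsum (A Vec.++ B) (inr y ∷ l) ≡ (rY (B ∪ ⁅ y ⁆) ∸ rY B) ∷ gains rsum (A Vec.++ (B ∪ ⁅ y ⁆)) l
    gains-inr A B y l rewrite ∪-⁅↑ʳ⁆ A B y | rsum-++ A (B ∪ ⁅ y ⁆) | rsum-++ A B =
      cong (_∷ gains rsum (A Vec.++ (B ∪ ⁅ y ⁆)) l) (ℕP.[m+n]∸[m+o]≡n∸o (rX A) _ _)

    gains-interleavings : ∀ A B p q →
      map (gains rsum (A Vec.++ B)) (interleavings (map inl p) (map inr q)) ≡ interleavings (gains rX A p) (gains rY B q)
    gains-interleavings A B [] q = cong (_∷ []) (gains-map-inr A B q)
      where
      gains-map-inr : ∀ A B q → gains rsum (A Vec.++ B) (map inr q) ≡ gains rY B q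
      gains-map-inr A B [] = refl
      gains-map-inr A B (y ∷ q) = trans (gains-inr A B y (map inr q)) (cong (_ ∷_) (gains-map-inr A (B ∪ ⁅ y ⁆) q))
    gains-interleavings A B (x ∷ p) [] = cong (_∷ []) (gains-map-inl A B (x ∷ p))
      where
      gains-map-inl : ∀ A B p → gains rsum (A Vec.++ B) (map inl p) ≡ gains rX A p
      gains-map-inl A B [] = refl
      gains-map-inl A B (x ∷ p) = trans (gains-inl A B x (map inl p)) (cong (_ ∷_) (gains-map-inl (A ∪ ⁅ x ⁆) B p))
    gains-interleavings A B (x ∷ p) (y ∷ q) = begin
      map (gains rsum (A Vec.++ B)) (map (inl x ∷_) Lˡ ++ map (inr y ∷_) Lʳ)
        ≡⟨ ListP.map-++ (gains rsum (A Vec.++ B)) (map (inl x ∷_) Lˡ) (map (inr y ∷_) Lʳ) ⟩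
      map (gains rsum (A Vec.++ B)) (map (inl x ∷_) Lˡ) ++ map (gains rsum (A Vec.++ B)) (map (inr y ∷_) Lʳ)
        ≡⟨ cong₂ _++_ (map-gains-∷ Lˡ (gains-inl A B x)) (map-gains-∷ Lʳ (gains-inr A B y)) ⟩
      map (_ ∷_) (map (gains rsum ((A ∪ ⁅ x ⁆) Vec.++ B)) Lˡ) ++ map (_ ∷_) (map (gains rsum (A Vec.++ (B ∪ ⁅ y ⁆))) Lʳ)
        ≡⟨ cong₂ (λ s t → map (_ ∷_) s ++ map (_ ∷_) t) (gains-interleavings (A ∪ ⁅ x ⁆) B p (y ∷ q)) (gains-interleavings A (B ∪ ⁅ y ⁆) (x ∷ p) q) ⟩
      interleavings (gains rX A (x ∷ p)) (gains rY B (y ∷ q)) ∎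
      where
      open ≡-Reasoning
      Lˡ = interleavings (map inl p) (map inr (y ∷ q))
      Lʳ = interleavings (map inl (x ∷ p)) (map inr q)
      map-gains-∷ : ∀ {S S′ z h} L → (∀ l → gains rsum S (z ∷ l) ≡ h ∷ gains rsum S′ l) →
        map (gains rsum S) (map (z ∷_) L) ≡ map (h ∷_) (map (gains rsum S′) L)
      map-gains-∷ L step = trans (sym (ListP.map-∘ L)) (trans (ListP.map-cong step L) (ListP.map-∘ L))

    compositions-interleavings : ∀ p q →
      map (map suc ∘ gains rsum ∅) (interleavings (map inl p) (map inr q)) ≡
      shuffles (map suc (gains rX ∅ p)) (map suc (gains rY ∅ q))
    compositions-interleavings p q = begin
      map (map suc ∘ gains rsum ∅) L
        ≡⟨ ListP.map-∘ L ⟩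
      map (map suc) (map (gains rsum ∅) L)
        ≡⟨ cong (λ S → map (map suc) (map (gains rsum S) L)) (∅-++ m n) ⟩
      map (map suc) (map (gains rsum (∅ {m} Vec.++ ∅ {n})) L)
        ≡⟨ cong (map (map suc)) (gains-interleavings ∅ ∅ p q) ⟩
      map (map suc) (interleavings (gains rX ∅ p) (gains rY ∅ q))
        ≡⟨ interleavings-map suc (gains rX ∅ p) (gains rY ∅ q) ⟨
      interleavings (map suc (gains rX ∅ p)) (map suc (gains rY ∅ q))
        ≡⟨ shuffles≡interleavings (map suc (gains rX ∅ p)) (map suc (gains rY ∅ q)) ⟨
      shuffles (map suc (gains rX ∅ p)) (map suc (gains rY ∅ q)) ∎
      where
      open ≡-Reasoning
      L = interleavings (map inl p) (map inr q)

    rankCompositions-⊕ : (TX : Subset m) (TY : Subset n) →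
      rankCompositions rsum (TX Vec.++ TY) ∼[ bag ] shuffleProduct (rankCompositions rX TX) (rankCompositions rY TY)
    rankCompositions-⊕ TX TY = begin
      map G (enumerations (TX Vec.++ TY))
        ≈⟨ map-cong (λ _ → refl) (enumerations-⊕ TX TY) ⟩
      map G (interleavedEnumerations TX TY)
        ≡⟨ ListP.map-concatMap G _ (enumerations TX) ⟩
      concatMap (λ p → map G (concatMap (λ q → interleavings (map inl p) (map inr q)) (enumerations TY))) (enumerations TX)
        ≡⟨ ListP.concatMap-cong (λ p → trans (ListP.map-concatMap G _ (enumerations TY))
                                            (ListP.concatMap-cong (compositions-interleavings p) (enumerations TY))) (enumerations TX) ⟩
      concatMap (λ p → concatMap (λ q → shuffles (Gˣ p) (Gʸ q)) (enumerations TY)) (enumerations TX)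
        ≡⟨ ListP.concatMap-cong (λ p → ListP.concatMap-map (shuffles (Gˣ p)) Gʸ (enumerations TY)) (enumerations TX) ⟨
      concatMap (λ p → concatMap (shuffles (Gˣ p)) (map Gʸ (enumerations TY))) (enumerations TX)
        ≡⟨ ListP.concatMap-map (λ α → concatMap (shuffles α) (map Gʸ (enumerations TY))) Gˣ (enumerations TX) ⟨
      shuffleProduct (rankCompositions rX TX) (rankCompositions rY TY) ∎
      where
      open import Relation.Binary.Reasoning.Setoid ([ bag ]-Equality Comp)
      G = map suc ∘ gains rsum ∅
      Gˣ = map suc ∘ gains rX ∅
      Gʸ = map suc ∘ gains rY ∅

-- Splitting enumerations: restriction and contraction

enumerates-addAll : {p : List (Fin m)} → Unique p → Enumerates (addAll ∅ p) p
enumerates-addAll {p = p} p! = record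
  { unique  = p!
  ; members = mk⇔ (λ z∈p → from (∈-addAll ∅ p) (inj₂ z∈p))
                  (λ z∈ → [ (λ z∈∅ → ⊥-elim (SubsetP.∉⊥ z∈∅)) , (λ z∈p → z∈p) ]′ (to (∈-addAll ∅ p) z∈))
  }

enumerates-++ : {T A : Subset m} {p q : List (Fin m)} →
  A ⊆ₛ T → Enumerates A p → Enumerates (T ─ A) q → Enumerates T (p ++ q)
enumerates-++ {T = T} {A} {p} {q} A⊆T ep eq = record
  { unique  = UniqueP.++⁺ (unique ep) (unique eq)
                λ (z∈p , z∈q) → proj₂ (∈-─⁻ (to (members eq) z∈q)) (to (members ep) z∈p)
  ; members = mk⇔
      (λ z∈ → [ A⊆T ∘ to (members ep) , proj₁ ∘ ∈-─⁻ ∘ to (members eq) ]′ (∈P.∈-++⁻ p z∈))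
      from′
  }
  where
  from′ : ∀ {z} → z ∈ₛ T → z ∈ p ++ q
  from′ {z} z∈T with z SubsetP.∈? A
  ... | yes z∈A = ∈P.∈-++⁺ˡ (from (members ep) z∈A)
  ... | no z∉A = ∈P.∈-++⁺ʳ p (from (members eq) (SubsetP.x∈p∧x∉q⇒x∈p─q z∈T z∉A))

enumerates-++⁻ : {T : Subset m} {p q : List (Fin m)} → Enumerates T (p ++ q) →
  addAll ∅ p ⊆ₛ T × Enumerates (addAll ∅ p) p × Enumerates (T ─ addAll ∅ p) q
enumerates-++⁻ {T = T} {p} {q} e with Unique-++⁻ p (unique e)
... | p! , q! , disj = A⊆T , eA , record
  { unique  = q!
  ; members = mk⇔
      (λ z∈q → SubsetP.x∈p∧x∉q⇒x∈p─q (to (members e) (∈P.∈-++⁺ʳ p z∈q)) (λ z∈A → disj (from (members eA) z∈A , z∈q)))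
      (λ z∈ → let z∈T , z∉A = ∈-─⁻ z∈ in
              [ (λ z∈p → ⊥-elim (z∉A (to (members eA) z∈p))) , (λ z∈q → z∈q) ]′ (∈P.∈-++⁻ p (from (members e) z∈T)))
  }
  where
  eA = enumerates-addAll p!
  A⊆T : addAll ∅ p ⊆ₛ T
  A⊆T z∈A = to (members e) (∈P.∈-++⁺ˡ (from (members eA) z∈A))

splitEnumerations : Subset m → List (List (Fin m) × List (Fin m))
splitEnumerations T =
  concatMap (λ A → concatMap (λ p → map (p ,_) (enumerations (T ─ A))) (enumerations A)) (subsetsOf T)

∈-splitEnumerations⁻ : {T : Subset m} {p q : List (Fin m)} → (p , q) ∈ splitEnumerations T →
  ∃ λ A → A ∈ subsetsOf T × Enumerates A p × Enumerates (T ─ A) q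
∈-splitEnumerations⁻ {T = T} pq∈ with find (∈P.∈-concatMap⁻ _ {xs = subsetsOf T} pq∈)
... | A , A∈ , pq∈′ with find (∈P.∈-concatMap⁻ _ {xs = enumerations A} pq∈′)
...   | p , p∈ , pq∈″ with ∈P.∈-map⁻ (p ,_) pq∈″
...     | q , q∈ , refl = A , A∈ , ∈-enumerations⁻ p∈ , ∈-enumerations⁻ q∈

enumerations-splits : (T : Subset m) → concatMap splits (enumerations T) ∼[ bag ] splitEnumerations T
enumerations-splits T = unique∧set⇒bag unique-splits unique-split (λ {(p , q)} → mk⇔ (to′ p q) (from′ p q))
  where
  unique-splits : Unique (concatMap splits (enumerations T))
  unique-splits = Unique-concatMap⁺ (enumerations-unique T) splits-unique
    λ {l} {l′} u v → trans (sym (∈-splits⁻ l u)) (∈-splits⁻ l′ v)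
  unique-split : Unique (splitEnumerations T)
  unique-split =
    Unique-concatMap⁺ (subsetsOf-unique T)
      (λ A → Unique-concatMap⁺ (enumerations-unique A)
               (λ p → UniqueP.map⁺ ProductP.,-injectiveʳ (enumerations-unique (T ─ A)))
               λ u v → same-p (∈P.∈-map⁻ _ u) (∈P.∈-map⁻ _ v))
      λ u v → same-A (find (∈P.∈-concatMap⁻ _ u)) (find (∈P.∈-concatMap⁻ _ v))
    where
    same-p : ∀ {p p′ z} {L L′ : List (List (Fin _))} →
      ∃ (λ q → q ∈ L × z ≡ (p , q)) → ∃ (λ q → q ∈ L′ × z ≡ (p′ , q)) → p ≡ p′
    same-p (_ , _ , refl) (_ , _ , refl) = refl
    same-A : ∀ {A A′ z} → ∃ (λ p → p ∈ enumerations A × z ∈ map (p ,_) (enumerations (T ─ A))) →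
                          ∃ (λ p → p ∈ enumerations A′ × z ∈ map (p ,_) (enumerations (T ─ A′))) → A ≡ A′
    same-A (p , p∈ , z∈) (p′ , p′∈ , z∈′) with ∈P.∈-map⁻ _ z∈ | ∈P.∈-map⁻ _ z∈′
    ... | _ , _ , refl | _ , _ , refl =
      trans (sym (addAll-enumeration (∈-enumerations⁻ p∈))) (addAll-enumeration (∈-enumerations⁻ p′∈))
  to′ : ∀ p q → (p , q) ∈ concatMap splits (enumerations T) → (p , q) ∈ splitEnumerations T
  to′ p q pq∈ with find (∈P.∈-concatMap⁻ splits {xs = enumerations T} pq∈)
  ... | l , l∈ , pq∈′ with ∈-splits⁻ l pq∈′
  ...   | refl with enumerates-++⁻ (∈-enumerations⁻ l∈)
  ...     | A⊆T , eA , eB =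
    ∈P.∈-concatMap⁺ _ (lose (∈-subsetsOf⁺ T _ A⊆T)
      (∈P.∈-concatMap⁺ _ (lose (∈-enumerations⁺ eA) (∈P.∈-map⁺ (p ,_) (∈-enumerations⁺ eB)))))
  from′ : ∀ p q → (p , q) ∈ splitEnumerations T → (p , q) ∈ concatMap splits (enumerations T)
  from′ p q pq∈ with ∈-splitEnumerations⁻ pq∈
  ... | A , A∈ , eA , eB =
    ∈P.∈-concatMap⁺ splits (lose (∈-enumerations⁺ (enumerates-++ (∈-subsetsOf⁻ T A∈) eA eB)) (∈-splits⁺ p q))

splits-gains : (r : Subset m → ℕ) (S : Subset m) (l : List (Fin m)) →
  splits (gains r S l) ≡ map (λ (p , q) → gains r S p , gains r (addAll S p) q) (splits l)
splits-gains r S [] = refl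
splits-gains r S (x ∷ l) = cong (([] , gains r S (x ∷ l)) ∷_) (begin
  map (Product.map₁ (_ ∷_)) (splits (gains r (S ∪ ⁅ x ⁆) l))
    ≡⟨ cong (map (Product.map₁ (_ ∷_))) (splits-gains r (S ∪ ⁅ x ⁆) l) ⟩
  map (Product.map₁ (_ ∷_)) (map (λ (p , q) → gains r (S ∪ ⁅ x ⁆) p , gains r (addAll (S ∪ ⁅ x ⁆) p) q) (splits l))
    ≡⟨ ListP.map-∘ (splits l) ⟨
  map (λ (p , q) → gains r S (x ∷ p) , gains r (addAll S (x ∷ p)) q) (splits l)
    ≡⟨ ListP.map-∘ (splits l) ⟩
  map (λ (p , q) → gains r S p , gains r (addAll S p) q) (map (Product.map₁ (x ∷_)) (splits l)) ∎)
  where open ≡-Reasoning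

deconcat-gains : (r : Subset m → ℕ) (l : List (Fin m)) →
  deconcat (map suc (gains r ∅ l)) ≡ map (λ (p , q) → map suc (gains r ∅ p) , map suc (gains r (addAll ∅ p) q)) (splits l)
deconcat-gains r l = begin
  deconcat (map suc (gains r ∅ l))
    ≡⟨ deconcat≡splits (map suc (gains r ∅ l)) ⟩
  splits (map suc (gains r ∅ l))
    ≡⟨ splits-map suc (gains r ∅ l) ⟩
  map (Product.map (map suc) (map suc)) (splits (gains r ∅ l))
    ≡⟨ cong (map _) (splits-gains r ∅ l) ⟩
  map (Product.map (map suc) (map suc)) (map (λ (p , q) → gains r ∅ p , gains r (addAll ∅ p) q) (splits l))
    ≡⟨ ListP.map-∘ (splits l) ⟨
  map (λ (p , q) → map suc (gains r ∅ p) , map suc (gains r (addAll ∅ p) q)) (splits l) ∎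
  where open ≡-Reasoning

contraction : (Subset m → ℕ) → Subset m → Subset m → ℕ
contraction r A B = r (A ∪ B) ∸ r A

module _ (r : Subset m → ℕ) (g : Subset m)
         (monotone : ∀ A B → A ⊆ₛ g → B ⊆ₛ g → A ⊆ₛ B → r A ≤ r B) where

  -- Monotonicity makes the truncated subtractions behave: r A ≤ r (A ∪ S).
  gains-contraction : ∀ A S q → A ⊆ₛ g → S ⊆ₛ g → (∀ {z} → z ∈ q → z ∈ₛ g) →
    gains (contraction r A) S q ≡ gains r (A ∪ S) q
  gains-contraction A S [] A⊆g S⊆g q⊆g = refl
  gains-contraction A S (x ∷ q) A⊆g S⊆g q⊆g = cong₂ _∷_ head
    (trans (gains-contraction A (S ∪ ⁅ x ⁆) q A⊆g S∪x⊆g (q⊆g ∘ there))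
           (cong (λ B → gains r B q) (sym (SubsetP.∪-assoc A S ⁅ x ⁆))))
    where
    ∪-⊆ : ∀ {B C} → B ⊆ₛ g → C ⊆ₛ g → B ∪ C ⊆ₛ g
    ∪-⊆ {B} {C} B⊆g C⊆g z∈ = [ B⊆g , C⊆g ]′ (SubsetP.x∈p∪q⁻ B C z∈)
    S∪x⊆g : S ∪ ⁅ x ⁆ ⊆ₛ g
    S∪x⊆g = ∪-⊆ S⊆g (λ z∈x → subst (_∈ₛ g) (sym (SubsetP.x∈⁅y⁆⇒x≡y x z∈x)) (q⊆g (here refl)))
    head : (r (A ∪ (S ∪ ⁅ x ⁆)) ∸ r A) ∸ (r (A ∪ S) ∸ r A) ≡ r ((A ∪ S) ∪ ⁅ x ⁆) ∸ r (A ∪ S)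
    head = begin
      (r (A ∪ (S ∪ ⁅ x ⁆)) ∸ r A) ∸ (r (A ∪ S) ∸ r A) ≡⟨ ℕP.∸-+-assoc (r (A ∪ (S ∪ ⁅ x ⁆))) (r A) _ ⟩
      r (A ∪ (S ∪ ⁅ x ⁆)) ∸ (r A + (r (A ∪ S) ∸ r A)) ≡⟨ cong (r (A ∪ (S ∪ ⁅ x ⁆)) ∸_) (ℕP.m+[n∸m]≡n rA≤rA∪S) ⟩
      r (A ∪ (S ∪ ⁅ x ⁆)) ∸ r (A ∪ S)                ≡⟨ cong (λ B → r B ∸ r (A ∪ S)) (SubsetP.∪-assoc A S ⁅ x ⁆) ⟨
      r ((A ∪ S) ∪ ⁅ x ⁆) ∸ r (A ∪ S)                ∎
      where
      open ≡-Reasoning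
      rA≤rA∪S = monotone A (A ∪ S) A⊆g (∪-⊆ A⊆g S⊆g) (SubsetP.p⊆p∪q S)

  gains-contraction-enumeration : ∀ {A p q} → A ⊆ₛ g → Enumerates A p → Enumerates (g ─ A) q →
    gains r (addAll ∅ p) q ≡ gains (contraction r A) ∅ q
  gains-contraction-enumeration {A} {p} {q} A⊆g ep eq = begin
    gains r (addAll ∅ p) q     ≡⟨ cong (λ B → gains r B q) (addAll-enumeration ep) ⟩
    gains r A q                ≡⟨ cong (λ B → gains r B q) (SubsetP.∪-identityʳ A) ⟨
    gains r (A ∪ ∅) q          ≡⟨ gains-contraction A ∅ q A⊆g (λ z∈∅ → ⊥-elim (SubsetP.∉⊥ z∈∅))
                                    (λ z∈q → proj₁ (∈-─⁻ (to (members eq) z∈q))) ⟨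
    gains (contraction r A) ∅ q  ∎
    where open ≡-Reasoning

  pairCompositions : List (Fin m) × List (Fin m) → Comp × Comp
  pairCompositions (p , q) = map suc (gains r ∅ p) , map suc (gains r (addAll ∅ p) q)

  pairCompositions-splitEnumerations : ∀ {A} → A ⊆ₛ g →
    map pairCompositions (concatMap (λ p → map (p ,_) (enumerations (g ─ A))) (enumerations A)) ≡
    List.cartesianProduct (rankCompositions r A) (rankCompositions (contraction r A) (g ─ A))
  pairCompositions-splitEnumerations {A} A⊆g = begin
    map pairCompositions (concatMap (λ p → map (p ,_) (enumerations (g ─ A))) (enumerations A))
      ≡⟨ ListP.map-concatMap pairCompositions _ (enumerations A) ⟩
    concatMap (λ p → map pairCompositions (map (p ,_) (enumerations (g ─ A)))) (enumerations A)
      ≡⟨ cong List.concat (ListP.map-cong-local (All.tabulate row)) ⟩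
    concatMap (λ p → map (G p ,_) (map Gᶜ (enumerations (g ─ A)))) (enumerations A)
      ≡⟨ ListP.concatMap-map (λ α → map (α ,_) (map Gᶜ (enumerations (g ─ A)))) G (enumerations A) ⟨
    concatMap (λ α → map (α ,_) (rankCompositions (contraction r A) (g ─ A))) (rankCompositions r A)
      ≡⟨ cartesianProduct≡concatMap (rankCompositions r A) _ ⟨
    List.cartesianProduct (rankCompositions r A) (rankCompositions (contraction r A) (g ─ A)) ∎
    where
    open ≡-Reasoning
    G = map suc ∘ gains r ∅
    Gᶜ = map suc ∘ gains (contraction r A) ∅
    row : ∀ {p} → p ∈ enumerations A →
      map pairCompositions (map (p ,_) (enumerations (g ─ A))) ≡ map (G p ,_) (map Gᶜ (enumerations (g ─ A)))
    row p∈ = trans (sym (ListP.map-∘ (enumerations (g ─ A))))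
      (trans (ListP.map-cong-local (All.tabulate (λ q∈ → cong (λ l → _ , map suc l)
                (gains-contraction-enumeration A⊆g (∈-enumerations⁻ p∈) (∈-enumerations⁻ q∈)))))
             (ListP.map-∘ (enumerations (g ─ A))))

  rankCompositions-splits : concatMap deconcat (rankCompositions r g) ∼[ bag ]
    concatMap (λ A → List.cartesianProduct (rankCompositions r A) (rankCompositions (contraction r A) (g ─ A))) (subsetsOf g)
  rankCompositions-splits = begin
    concatMap deconcat (map G (enumerations g))
      ≡⟨ ListP.concatMap-map deconcat G (enumerations g) ⟩
    concatMap (deconcat ∘ G) (enumerations g)
      ≡⟨ ListP.concatMap-cong (deconcat-gains r) (enumerations g) ⟩
    concatMap (map pairCompositions ∘ splits) (enumerations g)
      ≡⟨ ListP.map-concatMap pairCompositions splits (enumerations g) ⟨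
    map pairCompositions (concatMap splits (enumerations g))
      ≈⟨ map-cong (λ _ → refl) (enumerations-splits g) ⟩
    map pairCompositions (splitEnumerations g)
      ≡⟨ ListP.map-concatMap pairCompositions _ (subsetsOf g) ⟩
    concatMap (λ A → map pairCompositions (concatMap (λ p → map (p ,_) (enumerations (g ─ A))) (enumerations A))) (subsetsOf g)
      ≡⟨ cong List.concat (ListP.map-cong-local (All.tabulate (pairCompositions-splitEnumerations ∘ ∈-subsetsOf⁻ g))) ⟩
    concatMap (λ A → List.cartesianProduct (rankCompositions r A) (rankCompositions (contraction r A) (g ─ A))) (subsetsOf g) ∎
    where
    open import Relation.Binary.Reasoning.Setoid ([ bag ]-Equality (Comp × Comp))
    G = map suc ∘ gains r ∅

-- Coefficients and the structure maps

coeffTerm : Comp → ℚ × Comp → ℚ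
coeffTerm α (c , β) = if does (β ≟C α) then c else 0ℚ

coeff2Term : Comp → Comp → ℚ × Comp × Comp → ℚ
coeff2Term β γ (c , β′ , γ′) = if does (β′ ≟C β) then (if does (γ′ ≟C γ) then c else 0ℚ) else 0ℚ

coeff-foldr : (xs : QSym) (α : Comp) → coeff xs α ≡ foldr ℚ._+_ 0ℚ (map (coeffTerm α) xs)
coeff-foldr [] α = refl
coeff-foldr (cβ ∷ xs) α = cong (coeffTerm α cβ ℚ.+_) (coeff-foldr xs α)

coeff2-foldr : (xs : QSym2) (β γ : Comp) → coeff2 xs β γ ≡ foldr ℚ._+_ 0ℚ (map (coeff2Term β γ) xs)
coeff2-foldr [] β γ = refl
coeff2-foldr (cβγ ∷ xs) β γ = cong (coeff2Term β γ cβγ ℚ.+_) (coeff2-foldr xs β γ)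

foldr-+-bag : (f : A → ℚ) {xs ys : List A} → xs ∼[ bag ] ys →
  foldr ℚ._+_ 0ℚ (map f xs) ≡ foldr ℚ._+_ 0ℚ (map f ys)
foldr-+-bag f xs∼ys =
  PermSetoidP.foldr-commMonoid (setoid ℚ) ℚP.+-0-isCommutativeMonoid (↭⇒↭ₛ (PermP.map⁺ f (∼bag⇒↭ xs∼ys)))

bag⇒≈Q : {xs ys : QSym} → xs ∼[ bag ] ys → xs ≈Q ys
bag⇒≈Q {xs} {ys} xs∼ys α =
  trans (coeff-foldr xs α) (trans (foldr-+-bag (coeffTerm α) xs∼ys) (sym (coeff-foldr ys α)))

bag⇒≈Q2 : {xs ys : QSym2} → xs ∼[ bag ] ys → xs ≈Q2 ys
bag⇒≈Q2 {xs} {ys} xs∼ys β γ =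
  trans (coeff2-foldr xs β γ) (trans (foldr-+-bag (coeff2Term β γ) xs∼ys) (sym (coeff2-foldr ys β γ)))

*Q-cong : {x x′ y y′ : QSym} → x ∼[ bag ] x′ → y ∼[ bag ] y′ → x *Q y ∼[ bag ] x′ *Q y′
*Q-cong x∼x′ y∼y′ = >>=-cong x∼x′ (λ _ → >>=-cong y∼y′ (λ _ → Bag.refl))

shuffleRow : ℚ → Comp → QSym → QSym
shuffleRow a α y = concatMap (λ (b , β) → map (λ γ → (a ℚ.* b , γ)) (shuffles α β)) y

-- 1ℚ ℚ.* 1ℚ normalises to 1ℚ, so no coefficient arithmetic is needed here or in ones-⊗Q.
ones-*Q : (L M : List Comp) → ones L *Q ones M ≡ ones (shuffleProduct L M)
ones-*Q L M = begin
  ones L *Q ones M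
    ≡⟨ ListP.concatMap-map (λ (a , α) → shuffleRow a α (ones M)) (1ℚ ,_) L ⟩
  concatMap (λ α → shuffleRow 1ℚ α (ones M)) L
    ≡⟨ ListP.concatMap-cong (λ α → ListP.concatMap-map (λ (b , β) → map (λ γ → (1ℚ ℚ.* b , γ)) (shuffles α β)) (1ℚ ,_) M) L ⟩
  concatMap (λ α → concatMap (ones ∘ shuffles α) M) L
    ≡⟨ ListP.concatMap-cong (λ α → ListP.map-concatMap (1ℚ ,_) (shuffles α) M) L ⟨
  concatMap (λ α → ones (concatMap (shuffles α) M)) L
    ≡⟨ ListP.map-concatMap (1ℚ ,_) (λ α → concatMap (shuffles α) M) L ⟨
  ones (shuffleProduct L M) ∎
  where open ≡-Reasoning

scale-shuffleRow : ∀ a b c α v → shuffleRow (a ℚ.* c) α (scale b v) ≡ scale (a ℚ.* b) (shuffleRow c α v)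
scale-shuffleRow a b c α [] = refl
scale-shuffleRow a b c α ((d , β) ∷ v) = begin
  map (λ γ → ((a ℚ.* c) ℚ.* (b ℚ.* d) , γ)) (shuffles α β) ++ shuffleRow (a ℚ.* c) α (scale b v)
    ≡⟨ cong₂ _++_ (ListP.map-cong (λ γ → cong (_, γ) (interchange a c b d)) (shuffles α β)) (scale-shuffleRow a b c α v) ⟩
  map (λ γ → ((a ℚ.* b) ℚ.* (c ℚ.* d) , γ)) (shuffles α β) ++ scale (a ℚ.* b) (shuffleRow c α v)
    ≡⟨ cong (_++ scale (a ℚ.* b) (shuffleRow c α v)) (ListP.map-∘ (shuffles α β)) ⟩
  scale (a ℚ.* b) (map (λ γ → (c ℚ.* d , γ)) (shuffles α β)) ++ scale (a ℚ.* b) (shuffleRow c α v)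
    ≡⟨ ListP.map-++ _ (map (λ γ → (c ℚ.* d , γ)) (shuffles α β)) (shuffleRow c α v) ⟨
  scale (a ℚ.* b) (shuffleRow c α ((d , β) ∷ v)) ∎
  where
  open ≡-Reasoning
  open CommSemigroupProperties (CommutativeMonoid.commutativeSemigroup ℚP.*-1-commutativeMonoid) using (interchange)

scale-*Q : ∀ a b u v → scale a u *Q scale b v ≡ scale (a ℚ.* b) (u *Q v)
scale-*Q a b [] v = refl
scale-*Q a b ((c , α) ∷ u) v =
  trans (cong₂ _++_ (scale-shuffleRow a b c α v) (scale-*Q a b u v))
        (sym (ListP.map-++ _ (shuffleRow c α v) (u *Q v)))

*Q-concatMapʳ : (u : QSym) (f : A → QSym) (ys : List A) →
  u *Q concatMap f ys ∼[ bag ] concatMap (λ y → u *Q f y) ys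
*Q-concatMapʳ u f ys = begin
  u *Q concatMap f ys
    ≡⟨ ListP.concatMap-cong (λ (a , α) → concatMap-concatMap (λ (b , β) → map (λ γ → (a ℚ.* b , γ)) (shuffles α β)) f ys) u ⟩
  concatMap (λ (a , α) → concatMap (λ y → shuffleRow a α (f y)) ys) u
    ≈⟨ concatMap-comm (λ (a , α) y → shuffleRow a α (f y)) u ys ⟩
  concatMap (λ y → u *Q f y) ys ∎
  where open import Relation.Binary.Reasoning.Setoid ([ bag ]-Equality (ℚ × Comp))

𝒢₀-⊕ : (X Y : SetFn) → 𝒢₀ (X ⊕ Y) ∼[ bag ] 𝒢₀ X *Q 𝒢₀ Y
𝒢₀-⊕ X Y = begin
  𝒢₀ (X ⊕ Y)
    ≈⟨ 𝒢₀-enumerations (X ⊕ Y) ⟩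
  ones (rankCompositions (rk (X ⊕ Y)) (ground X Vec.++ ground Y))
    ≈⟨ map-cong (λ _ → refl) (DirectSum.rankCompositions-⊕ (rk X) (rk Y) (ground X) (ground Y)) ⟩
  ones (shuffleProduct (rankCompositions (rk X) (ground X)) (rankCompositions (rk Y) (ground Y)))
    ≡⟨ ones-*Q (rankCompositions (rk X) (ground X)) (rankCompositions (rk Y) (ground Y)) ⟨
  ones (rankCompositions (rk X) (ground X)) *Q ones (rankCompositions (rk Y) (ground Y))
    ≈⟨ *Q-cong (Bag.sym (𝒢₀-enumerations X)) (Bag.sym (𝒢₀-enumerations Y)) ⟩
  𝒢₀ X *Q 𝒢₀ Y ∎
  where open import Relation.Binary.Reasoning.Setoid ([ bag ]-Equality (ℚ × Comp))

𝒢-*P : (x y : PolyMat) → 𝒢 (x *P y) ∼[ bag ] 𝒢 x *Q 𝒢 y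
𝒢-*P x y = begin
  𝒢 (x *P y)
    ≡⟨ concatMap-concatMap 𝒢₁ (λ (a , X) → map (λ (b , Y) → (a ℚ.* b , X ⊕ Y)) y) x ⟩
  concatMap (λ (a , X) → concatMap 𝒢₁ (map (λ (b , Y) → (a ℚ.* b , X ⊕ Y)) y)) x
    ≡⟨ ListP.concatMap-cong (λ (a , X) → ListP.concatMap-map 𝒢₁ (λ (b , Y) → (a ℚ.* b , X ⊕ Y)) y) x ⟩
  concatMap (λ (a , X) → concatMap (λ (b , Y) → scale (a ℚ.* b) (𝒢₀ (X ⊕ Y))) y) x
    ≈⟨ concatMap-cong-bag x (λ (a , X) → concatMap-cong-bag y (λ (b , Y) →
         Bag.trans (map-cong (λ _ → refl) (𝒢₀-⊕ X Y)) (Bag.reflexive (sym (scale-*Q a b (𝒢₀ X) (𝒢₀ Y)))))) ⟩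
  concatMap (λ (a , X) → concatMap (λ (b , Y) → scale a (𝒢₀ X) *Q scale b (𝒢₀ Y)) y) x
    ≈⟨ concatMap-cong-bag x (λ (a , X) → Bag.sym (*Q-concatMapʳ (scale a (𝒢₀ X)) 𝒢₁ y)) ⟩
  concatMap (λ (a , X) → scale a (𝒢₀ X) *Q 𝒢 y) x
    ≡⟨ concatMap-concatMap _ 𝒢₁ x ⟨
  𝒢 x *Q 𝒢 y ∎
  where
  open import Relation.Binary.Reasoning.Setoid ([ bag ]-Equality (ℚ × Comp))
  𝒢₁ : ℚ × SetFn → QSym
  𝒢₁ (c , X) = scale c (𝒢₀ X)

ones2 : List (Comp × Comp) → QSym2
ones2 = map (λ (β , γ) → (1ℚ , β , γ))

scale2 : ℚ → QSym2 → QSym2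
scale2 c = map (λ (a , β , γ) → (c ℚ.* a , β , γ))

⊗Q-cong : {x x′ y y′ : QSym} → x ∼[ bag ] x′ → y ∼[ bag ] y′ → x ⊗Q y ∼[ bag ] x′ ⊗Q y′
⊗Q-cong x∼x′ y∼y′ = >>=-cong x∼x′ (λ _ → map-cong (λ _ → refl) y∼y′)

ΔQ-cong : {x x′ : QSym} → x ∼[ bag ] x′ → ΔQ x ∼[ bag ] ΔQ x′
ΔQ-cong x∼x′ = >>=-cong x∼x′ (λ _ → Bag.refl)

ones-⊗Q : (L M : List Comp) → ones L ⊗Q ones M ≡ ones2 (List.cartesianProduct L M)
ones-⊗Q L M = begin
  ones L ⊗Q ones M
    ≡⟨ ListP.concatMap-map (λ (a , α) → map (λ (b , β) → (a ℚ.* b , α , β)) (ones M)) (1ℚ ,_) L ⟩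
  concatMap (λ α → map (λ (b , β) → (1ℚ ℚ.* b , α , β)) (ones M)) L
    ≡⟨ ListP.concatMap-cong (λ α → trans (sym (ListP.map-∘ M)) (ListP.map-∘ M)) L ⟩
  concatMap (λ α → ones2 (map (α ,_) M)) L
    ≡⟨ ListP.map-concatMap _ (λ α → map (α ,_) M) L ⟨
  ones2 (concatMap (λ α → map (α ,_) M) L)
    ≡⟨ cong ones2 (cartesianProduct≡concatMap L M) ⟨
  ones2 (List.cartesianProduct L M) ∎
  where open ≡-Reasoning

ΔQ-ones : (L : List Comp) → ΔQ (ones L) ≡ ones2 (concatMap deconcat L)
ΔQ-ones L = trans (ListP.concatMap-map (λ (c , α) → map (λ (β , γ) → (c , β , γ)) (deconcat α)) (1ℚ ,_) L)
                  (sym (ListP.map-concatMap (λ (β , γ) → (1ℚ , β , γ)) deconcat L))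

ΔQ-scale : (c : ℚ) (u : QSym) → ΔQ (scale c u) ≡ scale2 c (ΔQ u)
ΔQ-scale c [] = refl
ΔQ-scale c ((a , α) ∷ u) =
  trans (cong₂ _++_ (ListP.map-∘ (deconcat α)) (ΔQ-scale c u)) (sym (ListP.map-++ _ _ (ΔQ u)))

𝒢₀-Δ : (X : SetFn) → IsPolymatroid X →
  ΔQ (𝒢₀ X) ∼[ bag ] concatMap (λ A → 𝒢₀ (restrict X A) ⊗Q 𝒢₀ (contract X A)) (subsetsOf (ground X))
𝒢₀-Δ X pm = begin
  ΔQ (𝒢₀ X)
    ≈⟨ ΔQ-cong (𝒢₀-enumerations X) ⟩
  ΔQ (ones (rankCompositions r g))
    ≡⟨ ΔQ-ones (rankCompositions r g) ⟩
  ones2 (concatMap deconcat (rankCompositions r g))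
    ≈⟨ map-cong (λ _ → refl) (rankCompositions-splits r g (IsPolymatroid.monotone pm)) ⟩
  ones2 (concatMap (λ A → List.cartesianProduct (rankCompositions r A) (rankCompositions (contraction r A) (g ─ A))) (subsetsOf g))
    ≡⟨ ListP.map-concatMap _ _ (subsetsOf g) ⟩
  concatMap (λ A → ones2 (List.cartesianProduct (rankCompositions r A) (rankCompositions (contraction r A) (g ─ A)))) (subsetsOf g)
    ≡⟨ ListP.concatMap-cong (λ A → ones-⊗Q (rankCompositions r A) (rankCompositions (contraction r A) (g ─ A))) (subsetsOf g) ⟨
  concatMap (λ A → ones (rankCompositions r A) ⊗Q ones (rankCompositions (contraction r A) (g ─ A))) (subsetsOf g)
    ≈⟨ concatMap-cong-bag (subsetsOf g) (λ A →
         ⊗Q-cong (Bag.sym (𝒢₀-enumerations (restrict X A))) (Bag.sym (𝒢₀-enumerations (contract X A)))) ⟩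
  concatMap (λ A → 𝒢₀ (restrict X A) ⊗Q 𝒢₀ (contract X A)) (subsetsOf g) ∎
  where
  open import Relation.Binary.Reasoning.Setoid ([ bag ]-Equality (ℚ × Comp × Comp))
  r = rk X
  g = ground X

𝒢-Δ : (x : PolyMat) → IsPolyMatElt x → ΔQ (𝒢 x) ∼[ bag ] 𝒢⊗𝒢 (ΔP x)
𝒢-Δ x pms = begin
  ΔQ (𝒢 x)
    ≡⟨ concatMap-concatMap _ (λ (c , X) → scale c (𝒢₀ X)) x ⟩
  concatMap (λ (c , X) → ΔQ (scale c (𝒢₀ X))) x
    ≈⟨ concatMap-cong-All pms (λ {(c , X)} pm →
         Bag.trans (Bag.reflexive (ΔQ-scale c (𝒢₀ X))) (map-cong (λ _ → refl) (𝒢₀-Δ X pm))) ⟩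
  concatMap (λ (c , X) → scale2 c (concatMap (λ A → 𝒢₀ (restrict X A) ⊗Q 𝒢₀ (contract X A)) (subsetsOf (ground X)))) x
    ≡⟨ ListP.concatMap-cong (λ (c , X) → scale2-concatMap c X) x ⟩
  concatMap (λ (c , X) → 𝒢⊗𝒢 (map (λ A → (c , restrict X A , contract X A)) (subsetsOf (ground X)))) x
    ≡⟨ concatMap-concatMap _ (λ (c , X) → map (λ A → (c , restrict X A , contract X A)) (subsetsOf (ground X))) x ⟨
  𝒢⊗𝒢 (ΔP x) ∎
  where
  open import Relation.Binary.Reasoning.Setoid ([ bag ]-Equality (ℚ × Comp × Comp))
  𝒢⊗𝒢₁ : ℚ × SetFn × SetFn → QSym2
  𝒢⊗𝒢₁ (c , X , Y) = scale2 c (𝒢₀ X ⊗Q 𝒢₀ Y)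
  scale2-concatMap : ∀ c X →
    scale2 c (concatMap (λ A → 𝒢₀ (restrict X A) ⊗Q 𝒢₀ (contract X A)) (subsetsOf (ground X))) ≡
    𝒢⊗𝒢 (map (λ A → (c , restrict X A , contract X A)) (subsetsOf (ground X)))
  scale2-concatMap c X =
    trans (ListP.map-concatMap (λ (a , β , γ) → (c ℚ.* a , β , γ)) (λ A → 𝒢₀ (restrict X A) ⊗Q 𝒢₀ (contract X A)) As)
          (sym (ListP.concatMap-map 𝒢⊗𝒢₁ (λ A → (c , restrict X A , contract X A)) As))
    where As = subsetsOf (ground X)

coeff-++ : (xs ys : QSym) (α : Comp) → coeff (xs ++ ys) α ≡ coeff xs α ℚ.+ coeff ys α
coeff-++ [] ys α = sym (ℚP.+-identityˡ (coeff ys α))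
coeff-++ (cβ ∷ xs) ys α =
  trans (cong (coeffTerm α cβ ℚ.+_) (coeff-++ xs ys α)) (sym (ℚP.+-assoc (coeffTerm α cβ) (coeff xs α) (coeff ys α)))

coeff-absent : (xs : QSym) (α : Comp) → (∀ {c β} → (c , β) ∈ xs → β ≢ α) → coeff xs α ≡ 0ℚ
coeff-absent [] α absent = refl
coeff-absent ((c , β) ∷ xs) α absent rewrite dec-false (β ≟C α) (absent (here refl)) =
  trans (ℚP.+-identityˡ (coeff xs α)) (coeff-absent xs α (absent ∘ there))

coeff-[]-orderings : (c : ℚ) (r : Subset m → ℕ) (k : ℕ) (T : Subset m) →
  coeff (scale c (ones (map (map suc ∘ gains r ∅) (orderings k T)))) [] ≡ (if k ℕ.≡ᵇ 0 then c else 0ℚ)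
coeff-[]-orderings c r ℕ.zero T = trans (ℚP.+-identityʳ (c ℚ.* 1ℚ)) (ℚP.*-identityʳ c)
coeff-[]-orderings c r (suc k) T = coeff-absent _ [] nonempty
  where
  nonempty : ∀ {c′ β} → (c′ , β) ∈ scale c (ones (map (map suc ∘ gains r ∅) (orderings (suc k) T))) → β ≢ []
  nonempty cβ∈ with ∈P.∈-map⁻ _ cβ∈
  ... | _ , cβ∈′ , refl with ∈P.∈-map⁻ _ cβ∈′
  ...   | _ , β∈ , refl with ∈P.∈-map⁻ _ β∈
  ...     | l , l∈ , refl with find (∈P.∈-concatMap⁻ _ {xs = elems T} l∈)
  ...       | x , _ , l∈′ with ∈P.∈-map⁻ (x ∷_) l∈′
  ...         | _ , _ , refl = λ ()

𝒢-ε : (x : PolyMat) → εQ (𝒢 x) ≡ εP x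
𝒢-ε [] = refl
𝒢-ε ((c , X) ∷ x) = begin
  coeff (scale c (𝒢₀ X) ++ 𝒢 x) []
    ≡⟨ coeff-++ (scale c (𝒢₀ X)) (𝒢 x) [] ⟩
  coeff (scale c (𝒢₀ X)) [] ℚ.+ coeff (𝒢 x) []
    ≡⟨ cong₂ ℚ._+_ (bag⇒≈Q (map-cong (λ _ → refl) (𝒢₀-enumerations X)) []) (𝒢-ε x) ⟩
  coeff (scale c (ones (rankCompositions (rk X) (ground X)))) [] ℚ.+ εP x
    ≡⟨ cong (ℚ._+ εP x) (coeff-[]-orderings c (rk X) ∣ ground X ∣ (ground X)) ⟩
  εP ((c , X) ∷ x) ∎
  where open ≡-Reasoning

-- Only the coproduct uses the polymatroid axioms; 𝒢 oneP and oneQ are the same list by computation.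
lemma7p2 : (∀ x y → IsPolyMatElt x → IsPolyMatElt y → 𝒢 (x *P y) ≈Q (𝒢 x *Q 𝒢 y))
    × (𝒢 oneP ≈Q oneQ)
    × (∀ x → IsPolyMatElt x → ΔQ (𝒢 x) ≈Q2 𝒢⊗𝒢 (ΔP x))
    × (∀ x → IsPolyMatElt x → εQ (𝒢 x) ≡ εP x)
lemma7p2 =
  (λ x y _ _ → bag⇒≈Q (𝒢-*P x y)) ,
  (λ α → refl) ,
  (λ x polymatroids → bag⇒≈Q2 (𝒢-Δ x polymatroids)) ,
  (λ x _ → 𝒢-ε x)
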